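{- A daisy has no clique separator, no proper 2-separator and no proper $P_3$-separator.
   Context: Graphs are finite and simple; a path means an induced path; an $ab$-path has ends $a,b$; for $X\subseteq V(G)$ an $aXb$-path is an $ab$-path with all internal vertices in $X$. A hole is a chordless cycle of length at least $4$. For a hole $C=c_1\dots c_kc_1$ (indices mod $k$), a petal with respect to $C$ is a path $P=x\dots y$ disjoint from $C$ such that for some $i$: $x$ is adjacent to $c_{i-1}$, $y$ to $c_{i+1}$, $c_i$ is adjacent to at least one internal vertex of $P$, no edge of $c_{i-1}xPyc_{i+1}$ has both ends adjacent to $c_i$, and no other edges between $P$ and $C$; $c_i$ is its centre. A daisy is a hole $C$ with petals with respect to $C$, no two with the same centre, whose centres induce a (possibly empty) subpath of $C$ or all of $C$, with no edges other than those of $C$, the petals, and between petals and $C$ as described. A clique separator of $G$ is a (possibly empty) set $K$ of pairwise adjacent vertices such that $G\setminus K$ has at least two components. A proper 2-separator of $G$ is a set $\{a,b\}$ of two nonadjacent vertices such that $G\setminus\{a,b\}$ has exactly two components $X,Y$ and, for each $Z\in\{X,Y\}$, $G$ contains an $aZb$-path and $G[Z\cup\{a,b\}]$ is not itself an $ab$-path. A proper $P_3$-separator of $G$ is a path $acb$ such that $G\setminus\{a,c,b\}$ has exactly two components, named $X,Y$ so that: $G$ contains an $aXb$-path and an $aYb$-path; $c$ has neighbours in both $X$ and $Y$; some $aXb$-path has no internal vertex adjacent to $c$; every $aYb$-path has an internal vertex adjacent to $c$; and neither $G[X\cup\{a,b\}]$ nor $G[Y\cup\{a,b\}]$ is an $ab$-path.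 -}

module Defs where

open import Data.Nat using (ℕ; zero; suc; _+_; _≤_; _<_)
open import Data.Fin using (Fin; toℕ)
open import Data.Fin.Subset using (Subset; _∈_; _∉_)
open import Data.Bool using (Bool; true; false)
open import Data.List using (List; []; _∷_; _++_; length; lookup)
open import Data.List.Membership.Propositional using () renaming (_∈_ to _∈L_)
open import Data.List.Relation.Unary.Unique.Propositional using (Unique)
open import Data.Maybe using (Maybe; just; nothing)
open import Data.Product using (Σ; ∃; ∃-syntax; _×_; _,_)
open import Data.Sum using (_⊎_)
open import Relation.Nullary using (¬_)
open import Relation.Binary.PropositionalEquality using (_≡_; _≢_)
open import Function.Bundles using (_⇔_)

record Graph (n : ℕ) : Set where
  field
    adj    : Fin n → Fin n → Bool
    sym    : ∀ u v → adj u v ≡ adj v u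
    irrefl : ∀ v → adj v v ≡ false

module _ {n : ℕ} (G : Graph n) where
  open Graph G

  E : Fin n → Fin n → Set
  E u v = adj u v ≡ true

  IsPath : List (Fin n) → Set
  IsPath L = Unique L ×
    (∀ (p q : Fin (length L)) →
       E (lookup L p) (lookup L q) ⇔ (suc (toℕ p) ≡ toℕ q ⊎ suc (toℕ q) ≡ toℕ p))

CycNext : (k : ℕ) → Fin k → Fin k → Set
CycNext k i j = suc (toℕ i) ≡ toℕ j ⊎ (suc (toℕ i) ≡ k × toℕ j ≡ 0)

module _ {n : ℕ} (G : Graph n) where

  IsHole : (k : ℕ) → (Fin k → Fin n) → Set
  IsHole k c = (4 ≤ k) × (∀ i j → c i ≡ c j → i ≡ j) ×
    (∀ i j → E G (c i) (c j) ⇔ (CycNext k i j ⊎ CycNext k j i))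

record Petal (n : ℕ) : Set where
  constructor petal
  field
    px : Fin n
    interior : List (Fin n)
    py : Fin n

petalVerts : ∀ {n} → Petal n → List (Fin n)
petalVerts (petal x I y) = x ∷ I ++ y ∷ []

module _ {n : ℕ} (G : Graph n) where

  NoEdgeBothAdj : Fin n → List (Fin n) → Set
  NoEdgeBothAdj z L = ∀ (p q : Fin (length L)) → suc (toℕ p) ≡ toℕ q →
    E G (lookup L p) (lookup L q) → ¬ (E G (lookup L p) z × E G (lookup L q) z)

  IsPetal : (k : ℕ) → (Fin k → Fin n) → Fin k → Petal n → Set
  IsPetal k c i (petal x I y) =
    IsPath G (x ∷ I ++ y ∷ []) ×
    (∀ v → v ∈L (x ∷ I ++ y ∷ []) → ∀ j → c j ≢ v) ×
    (∀ j → CycNext k j i → E G x (c j)) ×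
    (∀ j → CycNext k i j → E G y (c j)) ×
    (∃[ v ] (v ∈L I × E G v (c i))) ×
    (∀ j j' → CycNext k j i → CycNext k i j' →
       NoEdgeBothAdj (c i) (c j ∷ x ∷ I ++ y ∷ c j' ∷ [])) ×
    (∀ v j → v ∈L (x ∷ I ++ y ∷ []) → E G v (c j) →
       (CycNext k j i × v ≡ x) ⊎ (CycNext k i j × v ≡ y) ⊎ (j ≡ i × v ∈L I))

-- i lies in the cyclic interval {s, s+1, ..., s+m-1} of Z/k  (m ≤ k)
InCycInterval : (k : ℕ) → Fin k → ℕ → Fin k → Set
InCycInterval k s m i =
  (toℕ s ≤ toℕ i × toℕ i < toℕ s + m) ⊎ (toℕ i + k < toℕ s + m)

record IsDaisy {n : ℕ} (G : Graph n) : Set where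
  field
    k       : ℕ
    c       : Fin k → Fin n
    hole    : IsHole G k c
    -- petal i = just P  iff  there is a petal P with centre c i
    petals  : Fin k → Maybe (Petal n)
    petalOK : ∀ i P → petals i ≡ just P → IsPetal G k c i P
    -- the centres induce a (possibly empty) subpath of C or all of C
    centres : ∃[ s ] ∃[ m ] (m ≤ k ×
                (∀ i → (∃[ P ] petals i ≡ just P) ⇔ InCycInterval k s m i))
    disjoint : ∀ i j P Q v → petals i ≡ just P → petals j ≡ just Q →
                 v ∈L petalVerts P → v ∈L petalVerts Q → i ≡ j
    cover   : ∀ v → (∃[ i ] c i ≡ v) ⊎
                    (∃[ i ] ∃[ P ] (petals i ≡ just P × v ∈L petalVerts P))
    edges   : ∀ u v → E G u v →
                ((∃[ i ] c i ≡ u) × (∃[ j ] c j ≡ v)) ⊎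
                (∃[ i ] ∃[ P ] (petals i ≡ just P ×
                   (u ∈L petalVerts P ⊎ (∃[ j ] c j ≡ u)) ×
                   (v ∈L petalVerts P ⊎ (∃[ j ] c j ≡ v))))

module _ {n : ℕ} (G : Graph n) where

  data ReachIn (X : Subset n) : Fin n → Fin n → Set where
    here : ∀ {u} → u ∈ X → ReachIn X u u
    step : ∀ {u w v} → u ∈ X → E G u w → ReachIn X w v → ReachIn X u v

  IsComponent : Subset n → Subset n → Set
  IsComponent S X =
    (∀ v → v ∈ X → v ∉ S) ×
    (∃[ v ] v ∈ X) ×
    (∀ u v → u ∈ X → v ∈ X → ReachIn X u v) ×
    (∀ u v → u ∈ X → E G u v → v ∉ S → v ∈ X)

  ExactlyTwoComponents : Subset n → Subset n → Subset n → Set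
  ExactlyTwoComponents S X Y =
    IsComponent S X × IsComponent S Y × X ≢ Y × (∀ v → v ∉ S → v ∈ X ⊎ v ∈ Y)

  IsABPathVia : Fin n → Fin n → Subset n → List (Fin n) → Set
  IsABPathVia a b X I = IsPath G (a ∷ I ++ b ∷ []) × (∀ v → v ∈L I → v ∈ X)

  InducesABPath : Fin n → Fin n → Subset n → Set
  InducesABPath a b Z = ∃[ I ] (IsPath G (a ∷ I ++ b ∷ []) × (∀ v → v ∈ Z ⇔ v ∈L I))

  HasCliqueSeparator : Set
  HasCliqueSeparator = ∃[ K ] ((∀ u v → u ∈ K → v ∈ K → u ≢ v → E G u v) ×
    (∃[ X ] ∃[ Y ] (IsComponent K X × IsComponent K Y × X ≢ Y)))

  IsProper2Separator : Fin n → Fin n → Set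
  IsProper2Separator a b = a ≢ b × ¬ E G a b × ∃[ S ] ∃[ X ] ∃[ Y ] (
    (∀ v → v ∈ S ⇔ (v ≡ a ⊎ v ≡ b)) ×
    ExactlyTwoComponents S X Y ×
    (∃[ I ] IsABPathVia a b X I) × ¬ InducesABPath a b X ×
    (∃[ I ] IsABPathVia a b Y I) × ¬ InducesABPath a b Y)

  HasProper2Separator : Set
  HasProper2Separator = ∃[ a ] ∃[ b ] IsProper2Separator a b

  IsProperP3Separator : Fin n → Fin n → Fin n → Set
  IsProperP3Separator a c b = IsPath G (a ∷ c ∷ b ∷ []) × ∃[ S ] ∃[ X ] ∃[ Y ] (
    (∀ v → v ∈ S ⇔ (v ≡ a ⊎ v ≡ c ⊎ v ≡ b)) ×
    ExactlyTwoComponents S X Y ×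
    (∃[ I ] IsABPathVia a b X I) ×
    (∃[ I ] IsABPathVia a b Y I) ×
    (∃[ v ] (v ∈ X × E G c v)) ×
    (∃[ v ] (v ∈ Y × E G c v)) ×
    (∃[ I ] (IsABPathVia a b X I × (∀ v → v ∈L I → ¬ E G c v))) ×
    (∀ I → IsABPathVia a b Y I → ∃[ v ] (v ∈L I × E G c v)) ×
    ¬ InducesABPath a b X × ¬ InducesABPath a b Y)

  HasProperP3Separator : Set
  HasProperP3Separator = ∃[ a ] ∃[ c ] ∃[ b ] IsProperP3Separator a c b

{-# OPTIONS --safe #-}
-- A daisy is triangle-free, so a clique K lies within an edge {u, w}. For S = {u, w}, a pair {a, b}
-- or a path a c b, the hole vertices in S form a short arc of the hole C, unless a and b are nonadjacent
-- vertices of C. In the arc case the rest of C is a path avoiding S, and each petal vertex outside S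
-- reaches it along its petal or through the centre, unless it lies on a stretch of its petal between
-- two vertices of S that nothing else outside S touches. The ends of such a stretch are distinct and
-- nonadjacent: for S = {u, w} there is none, so G \ {u, w}, and with it G \ K, is connected;
-- otherwise the stretch runs from a to b and is a component of G \ S inducing an ab-path.
-- When a, b ∈ C are nonadjacent, a petal centred at a or b joins the two arcs of C \ {a, b};
-- otherwise the centres, which form an interval of C, lie on one arc, and the other arc is a
-- component inducing an ab-path.

module Submission where

open import Defs
open import Data.Nat using (ℕ; zero; suc; pred; _+_; _*_; _∸_; _≤_; _<_; z≤n; s≤s; NonZero; _%_; _/_; _≤?_; _<?_)
open import Data.Nat.Base using (>-nonZero)
open import Data.Nat.Properties
open import Data.Nat.DivMod using (_mod_; %-distribˡ-+; m%n%n≡m%n; m≡m%n+[m/n]*n; m%n≤n; [m+kn]%n≡m%n; m<n⇒m%n≡m; m%n<n; n%n≡0; [m+n]%n≡m%n; m≤n⇒[n∸m]%m≡n%m)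
open import Data.Fin using (Fin; toℕ; fromℕ<)
open import Data.Fin.Properties using (toℕ<n; toℕ-injective; toℕ-fromℕ<; any?) renaming (_≟_ to _≟ᶠ_)
open import Data.Fin.Subset using (Subset; _∈_; _∉_; ⁅_⁆; _∪_)
open import Data.Fin.Subset.Properties using (⊆-antisym; _∈?_; x∈⁅x⁆; x∈⁅y⁆⇒x≡y; x∈p∪q⁻; x∈p∪q⁺)
open import Data.Bool using (true)
import Data.Bool.Properties as Bool
open import Data.List using (List; []; _∷_; _++_; length; lookup; applyUpTo)
open import Data.List.Properties using (length-applyUpTo; lookup-applyUpTo; applyUpTo-∷ʳ; length-++)
open import Data.List.Membership.Propositional using () renaming (_∈_ to _∈L_)
open import Data.List.Membership.Propositional.Properties using (∈-applyUpTo⁺; ∈-applyUpTo⁻)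
open import Data.List.Relation.Unary.Any using (here; there)
open import Data.List.Relation.Unary.All using ([]; _∷_) renaming (lookup to All-lookup)
open import Data.List.Relation.Unary.AllPairs using (_∷_)
open import Data.List.Relation.Unary.Unique.Propositional using (Unique)
open import Data.List.Relation.Unary.Unique.Propositional.Properties using (applyUpTo⁺₁)
open import Data.Maybe using (just; nothing)
open import Data.Product using (Σ; ∃-syntax; _×_; _,_; proj₁; proj₂; uncurry)
open import Data.Sum using (_⊎_; inj₁; inj₂; [_,_]′)
import Data.Sum as Sum
open import Data.Empty using (⊥; ⊥-elim)
open import Relation.Nullary using (¬_; Dec; yes; no)
open import Relation.Nullary.Decidable using (_×-dec_; ¬?)
open import Relation.Binary.Definitions using (tri<; tri≈; tri>)
open import Relation.Binary.PropositionalEquality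
open import Function.Bundles using (_⇔_; Equivalence; mk⇔)

module Walks {n : ℕ} (G : Graph n) where
  open Graph G renaming (sym to adj-sym; irrefl to adj-irrefl)

  E-sym : ∀ {u v} → E G u v → E G v u
  E-sym {u} {v} e = trans (adj-sym v u) e

  E-irrefl : ∀ {v} → ¬ E G v v
  E-irrefl {v} e with trans (sym (adj-irrefl v)) e
  ... | ()

  E⇒≢ : ∀ {u v} → E G u v → u ≢ v
  E⇒≢ e refl = E-irrefl e

  E? : ∀ u v → Dec (E G u v)
  E? u v = adj u v Bool.≟ true

  data Walk (Ok : Fin n → Set) : Fin n → Fin n → Set where
    wnil  : ∀ {u} → Ok u → Walk Ok u u
    wcons : ∀ {u w v} → Ok u → E G u w → Walk Ok w v → Walk Ok u v

  module _ {Ok : Fin n → Set} where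
    infixr 5 _++ʷ_

    head-ok : ∀ {u v} → Walk Ok u v → Ok u
    head-ok (wnil o) = o
    head-ok (wcons o _ _) = o

    last-ok : ∀ {u v} → Walk Ok u v → Ok v
    last-ok (wnil o) = o
    last-ok (wcons _ _ w) = last-ok w

    _++ʷ_ : ∀ {u v x} → Walk Ok u v → Walk Ok v x → Walk Ok u x
    wnil _ ++ʷ q = q
    wcons o e p ++ʷ q = wcons o e (p ++ʷ q)

    snocʷ : ∀ {u v x} → Walk Ok u v → E G v x → Ok x → Walk Ok u x
    snocʷ p e o = p ++ʷ wcons (last-ok p) e (wnil o)

    reverseʷ : ∀ {u v} → Walk Ok u v → Walk Ok v u
    reverseʷ (wnil o) = wnil o
    reverseʷ (wcons o e p) = snocʷ (reverseʷ p) (E-sym e) o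

  mapʷ : ∀ {Ok Ok′ : Fin n → Set} → (∀ v → Ok v → Ok′ v) → ∀ {u v} → Walk Ok u v → Walk Ok′ u v
  mapʷ f (wnil o) = wnil (f _ o)
  mapʷ f (wcons o e p) = wcons (f _ o) e (mapʷ f p)

  Outside : Subset n → Fin n → Set
  Outside S v = v ∉ S

  ClosedOutside : Subset n → (Fin n → Set) → Set
  ClosedOutside S P = ∀ {u w} → P u → E G u w → w ∉ S → P w

  walk-preserves : ∀ {S P} → ClosedOutside S P → ∀ {u v} → P u → Walk (Outside S) u v → P v
  walk-preserves cl pu (wnil _) = pu
  walk-preserves cl pu (wcons _ e p) = walk-preserves cl (cl pu e (head-ok p)) p

  ReachIn⇒Walk : ∀ {S X} → IsComponent G S X → ∀ {u v} → ReachIn G X u v → Walk (Outside S) u v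
  ReachIn⇒Walk C (here x) = wnil (proj₁ C _ x)
  ReachIn⇒Walk C (step x e r) = wcons (proj₁ C _ x) e (ReachIn⇒Walk C r)

  component-walk-closed : ∀ {S X} → IsComponent G S X → ∀ {u v} → u ∈ X → Walk (Outside S) u v → v ∈ X
  component-walk-closed (_ , _ , _ , closed) = walk-preserves (λ ux e wS → closed _ _ ux e wS)

  components-sharing-vertex-≡ : ∀ {S X Y} → IsComponent G S X → IsComponent G S Y →
                                ∀ {r} → r ∈ X → r ∈ Y → X ≡ Y
  components-sharing-vertex-≡ CX@(_ , _ , reachX , _) CY@(_ , _ , reachY , _) rX rY =
    ⊆-antisym (λ vX → component-walk-closed CY rY (ReachIn⇒Walk CX (reachX _ _ rX vX)))
              (λ vY → component-walk-closed CX rX (ReachIn⇒Walk CY (reachY _ _ rY vY)))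

  two-components-not-connected : ∀ {S X Y} → IsComponent G S X → IsComponent G S Y → X ≢ Y →
                                 ∀ r → (∀ v → v ∉ S → Walk (Outside S) v r) → ⊥
  two-components-not-connected CX@(outX , (x , xX) , _) CY@(outY , (y , yY) , _) X≢Y r to-r =
    X≢Y (components-sharing-vertex-≡ CX CY (component-walk-closed CX xX (to-r x (outX _ xX)))
                                           (component-walk-closed CY yY (to-r y (outY _ yY))))

module IndexedPaths {n : ℕ} (G : Graph n) where
  open Walks G

  record IsIndexedPath (g : ℕ → Fin n) (N : ℕ) : Set where
    field
      injective            : ∀ t t' → t ≤ N → t' ≤ N → g t ≡ g t' → t ≡ t'
      adjacent⇒consecutive : ∀ t t' → t ≤ N → t' ≤ N → E G (g t) (g t') → suc t ≡ t' ⊎ suc t' ≡ t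
      consecutive-adjacent : ∀ t → t < N → E G (g t) (g (suc t))
  open IsIndexedPath public

  indexedPath⇒IsPath : ∀ (g : ℕ → Fin n) N → IsIndexedPath g N → IsPath G (applyUpTo g (suc N))
  indexedPath⇒IsPath g N ip = unique , λ p q → mk⇔ (to p q) (from p q)
    where
    L : List (Fin n)
    L = applyUpTo g (suc N)
    bound : (p : Fin (length L)) → toℕ p ≤ N
    bound p = ≤-pred (subst (toℕ p <_) (length-applyUpTo g (suc N)) (toℕ<n p))
    unique : Unique L
    unique = applyUpTo⁺₁ g (suc N) (λ {i} {j} i<j j<1+N eq →
               <⇒≢ i<j (injective ip i j (<⇒≤ (<-≤-trans i<j (≤-pred j<1+N))) (≤-pred j<1+N) eq))
    to : ∀ p q → E G (lookup L p) (lookup L q) → suc (toℕ p) ≡ toℕ q ⊎ suc (toℕ q) ≡ toℕ p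
    to p q e rewrite lookup-applyUpTo g (suc N) p | lookup-applyUpTo g (suc N) q =
      adjacent⇒consecutive ip (toℕ p) (toℕ q) (bound p) (bound q) e
    from : ∀ p q → suc (toℕ p) ≡ toℕ q ⊎ suc (toℕ q) ≡ toℕ p → E G (lookup L p) (lookup L q)
    from p q h rewrite lookup-applyUpTo g (suc N) p | lookup-applyUpTo g (suc N) q with h
    ... | inj₁ eq = subst (λ z → E G (g (toℕ p)) (g z)) eq (consecutive-adjacent ip (toℕ p) (subst (_≤ N) (sym eq) (bound q)))
    ... | inj₂ eq = E-sym (subst (λ z → E G (g (toℕ q)) (g z)) eq (consecutive-adjacent ip (toℕ q) (subst (_≤ N) (sym eq) (bound p))))

  indexedPath-reverse : ∀ (g : ℕ → Fin n) N → IsIndexedPath g N → IsIndexedPath (λ t → g (N ∸ t)) N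
  indexedPath-reverse g N ip = record
    { injective = λ t t' t≤N t'≤N eq → ∸-cancelˡ-≡ t≤N t'≤N (injective ip _ _ (m∸n≤m N t) (m∸n≤m N t') eq)
    ; adjacent⇒consecutive = adjacent
    ; consecutive-adjacent = λ t t<N → subst (λ z → E G (g z) (g (N ∸ suc t))) (sym (∸-suc t<N))
                               (E-sym (consecutive-adjacent ip (N ∸ suc t) (∸-monoʳ-< (s≤s z≤n) t<N)))
    }
    where
    ∸-suc : ∀ {t N} → t < N → N ∸ t ≡ suc (N ∸ suc t)
    ∸-suc {zero} {suc N} _ = refl
    ∸-suc {suc t} {suc N} (s≤s t<N) = ∸-suc t<N
    reflect : ∀ {t t'} → t ≤ N → t' ≤ N → suc (N ∸ t) ≡ N ∸ t' → suc t' ≡ t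
    reflect {t} {t'} t≤N t'≤N eq = +-cancelˡ-≡ (N ∸ t) _ _ (begin
      (N ∸ t) + suc t'  ≡⟨ +-suc (N ∸ t) t' ⟩
      suc (N ∸ t) + t'  ≡⟨ cong (_+ t') eq ⟩
      (N ∸ t') + t'     ≡⟨ m∸n+n≡m t'≤N ⟩
      N                 ≡⟨ m∸n+n≡m t≤N ⟨
      (N ∸ t) + t       ∎)
      where open ≡-Reasoning
    adjacent : ∀ t t' → t ≤ N → t' ≤ N → E G (g (N ∸ t)) (g (N ∸ t')) → suc t ≡ t' ⊎ suc t' ≡ t
    adjacent t t' t≤N t'≤N e with adjacent⇒consecutive ip _ _ (m∸n≤m N t) (m∸n≤m N t') e
    ... | inj₁ eq = inj₂ (reflect t≤N t'≤N eq)
    ... | inj₂ eq = inj₁ (reflect t'≤N t≤N eq)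

  indexedPath-window : ∀ (g : ℕ → Fin n) N → IsIndexedPath g N →
                       ∀ i M → i + M ≤ N → IsIndexedPath (λ t → g (i + t)) M
  indexedPath-window g N ip i M i+M≤N = record
    { injective = λ t t' t≤M t'≤M eq → +-cancelˡ-≡ i _ _ (injective ip _ _ (inside t≤M) (inside t'≤M) eq)
    ; adjacent⇒consecutive = adjacent
    ; consecutive-adjacent = λ t t<M → subst (λ z → E G (g (i + t)) (g z)) (sym (+-suc i t))
                               (consecutive-adjacent ip (i + t) (subst (_≤ N) (+-suc i t) (inside t<M)))
    }
    where
    inside : ∀ {t} → t ≤ M → i + t ≤ N
    inside t≤M = ≤-trans (+-monoʳ-≤ i t≤M) i+M≤N
    adjacent : ∀ t t' → t ≤ M → t' ≤ M → E G (g (i + t)) (g (i + t')) → suc t ≡ t' ⊎ suc t' ≡ t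
    adjacent t t' t≤M t'≤M e with adjacent⇒consecutive ip _ _ (inside t≤M) (inside t'≤M) e
    ... | inj₁ eq = inj₁ (+-cancelˡ-≡ i _ _ (trans (+-suc i t) eq))
    ... | inj₂ eq = inj₂ (+-cancelˡ-≡ i _ _ (trans (+-suc i t') eq))

  walk-up : ∀ {Ok : Fin n → Set} (g : ℕ → Fin n) {x} y → x ≤ y → (∀ s → x ≤ s → s ≤ y → Ok (g s)) →
            (∀ s → x ≤ s → s < y → E G (g s) (g (suc s))) → Walk Ok (g x) (g y)
  walk-up g zero z≤n ok _ = wnil (ok 0 z≤n z≤n)
  walk-up g (suc y) x≤1+y ok adj with m≤n⇒m<n∨m≡n x≤1+y
  ... | inj₂ refl = wnil (ok (suc y) ≤-refl ≤-refl)
  ... | inj₁ x<1+y = snocʷ (walk-up g y x≤y (λ s a b → ok s a (m≤n⇒m≤1+n b)) (λ s a b → adj s a (m<n⇒m<1+n b)))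
                            (adj y x≤y ≤-refl) (ok (suc y) x≤1+y ≤-refl)
    where
    x≤y : _ ≤ y
    x≤y = ≤-pred x<1+y

  walk-along : ∀ {Ok : Fin n → Set} (g : ℕ → Fin n) lo hi → (∀ s → lo ≤ s → s ≤ hi → Ok (g s)) →
               (∀ s → lo ≤ s → s < hi → E G (g s) (g (suc s))) →
               ∀ x y → lo ≤ x → x ≤ hi → lo ≤ y → y ≤ hi → Walk Ok (g x) (g y)
  walk-along g lo hi ok adj x y lo≤x x≤hi lo≤y y≤hi with x ≤? y
  ... | yes x≤y = walk-up g y x≤y (λ s a b → ok s (≤-trans lo≤x a) (≤-trans b y≤hi))
                                  (λ s a b → adj s (≤-trans lo≤x a) (<-≤-trans b y≤hi))
  ... | no x≰y = reverseʷ (walk-up g x (≰⇒≥ x≰y) (λ s a b → ok s (≤-trans lo≤y a) (≤-trans b x≤hi))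
                                                  (λ s a b → adj s (≤-trans lo≤y a) (<-≤-trans b x≤hi)))

  walk-within : ∀ {Ok : Fin n → Set} (g : ℕ → Fin n) lo hi → (∀ s → lo < s → s < hi → Ok (g s)) →
                (∀ s → lo < s → suc s < hi → E G (g s) (g (suc s))) →
                ∀ x y → lo < x → x < hi → lo < y → y < hi → Walk Ok (g x) (g y)
  walk-within g lo (suc h) ok adj x y lo<x x<hi lo<y y<hi =
    walk-along g (suc lo) h (λ s a b → ok s a (s≤s b)) (λ s a b → adj s a (s≤s b)) x y lo<x (≤-pred x<hi) lo<y (≤-pred y<hi)

  Inner : ℕ → ℕ → Set
  Inner M t = 1 ≤ t × t ≤ M

  record ABPiece (S : Subset n) (a b y : Fin n) : Set where
    field
      path     : ℕ → Fin n
      M        : ℕ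
      indexed  : IsIndexedPath path (suc M)
      starts   : path 0 ≡ a
      ends     : path (suc M) ≡ b
      position : ℕ
      inner    : Inner M position
      at-y     : path position ≡ y
      avoids   : ∀ t → Inner M t → path t ∉ S
      closed   : ∀ t w → Inner M t → E G (path t) w → w ∉ S → ∃[ t' ] (Inner M t' × path t' ≡ w)

  component-induces-ABPath : ∀ {S Y a b y} → IsComponent G S Y → y ∈ Y → ABPiece S a b y →
                             InducesABPath G a b Y
  component-induces-ABPath {S} {Y} {a} {b} {y} CY@(_ , _ , reachY , _) yY piece =
    interior , isPath , λ v → mk⇔ (Y⇒interior v) (interior⇒Y v)
    where
    open ABPiece piece
    interior : List (Fin n)
    interior = applyUpTo (λ i → path (suc i)) M
    isPath : IsPath G (a ∷ interior ++ b ∷ [])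
    isPath = subst₂ (λ a b → IsPath G (a ∷ interior ++ b ∷ [])) starts ends
               (subst (IsPath G) (cong (path 0 ∷_) (sym (applyUpTo-∷ʳ (λ i → path (suc i)) M)))
                 (indexedPath⇒IsPath path (suc M) indexed))
    OnInterior : Fin n → Set
    OnInterior w = ∃[ t ] (Inner M t × path t ≡ w)
    Y⇒interior : ∀ v → v ∈ Y → v ∈L interior
    Y⇒interior v vY with walk-preserves {P = OnInterior} (λ { (t , t-in , refl) e wS → closed t _ t-in e wS })
                           (position , inner , at-y) (ReachIn⇒Walk CY (reachY _ _ yY vY))
    ... | suc i , (_ , i<M) , refl = ∈-applyUpTo⁺ _ i<M
    interior⇒Y : ∀ v → v ∈L interior → v ∈ Y
    interior⇒Y v v∈ with ∈-applyUpTo⁻ _ v∈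
    ... | i , i<M , refl = component-walk-closed CY yY
          (subst₂ (Walk (Outside S)) at-y refl
            (walk-along path 1 M (λ s a b → avoids s (a , b))
              (λ s _ s<M → consecutive-adjacent indexed s (m<n⇒m<1+n s<M))
              position (suc i) (proj₁ inner) (proj₂ inner) (s≤s z≤n) i<M))

  far-component-induces-ABPath : ∀ {S X Y a b r} → IsComponent G S X → IsComponent G S Y → X ≢ Y → r ∈ X →
                                 (∀ v → v ∉ S → Walk (Outside S) v r ⊎ ABPiece S a b v) →
                                 InducesABPath G a b Y
  far-component-induces-ABPath CX CY@(outY , (y , yY) , _) X≢Y rX to-r-or-piece with to-r-or-piece y (outY _ yY)
  ... | inj₁ y→r = ⊥-elim (X≢Y (components-sharing-vertex-≡ CX CY rX (component-walk-closed CY yY y→r)))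
  ... | inj₂ piece = component-induces-ABPath CY yY piece

  one-component-induces-ABPath : ∀ {S X Y a b} → ExactlyTwoComponents G S X Y → ∀ r → r ∉ S →
                                 (∀ v → v ∉ S → Walk (Outside S) v r ⊎ ABPiece S a b v) →
                                 InducesABPath G a b X ⊎ InducesABPath G a b Y
  one-component-induces-ABPath (CX , CY , X≢Y , cover) r rS to-r-or-piece with cover r rS
  ... | inj₁ rX = inj₂ (far-component-induces-ABPath CX CY X≢Y rX to-r-or-piece)
  ... | inj₂ rY = inj₁ (far-component-induces-ABPath CY CX (λ eq → X≢Y (sym eq)) rY to-r-or-piece)

  ABPiece-swap : ∀ {S a b y} → ABPiece S b a y → ABPiece S a b y
  ABPiece-swap {S} {a} {b} {y} piece = record
    { path     = λ t → path (suc M ∸ t)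
    ; M        = M
    ; indexed  = indexedPath-reverse path (suc M) indexed
    ; starts   = ends
    ; ends     = trans (cong path (n∸n≡0 (suc M))) starts
    ; position = suc M ∸ position
    ; inner    = reflect-inner inner
    ; at-y     = trans (cong path (reflect-involutive inner)) at-y
    ; avoids   = λ t t-in → avoids _ (reflect-inner t-in)
    ; closed   = λ t w t-in e wS → closed′ (closed _ w (reflect-inner t-in) e wS)
    }
    where
    open ABPiece piece
    reflect-inner : ∀ {t} → Inner M t → Inner M (suc M ∸ t)
    reflect-inner (1≤t , t≤M) = m<n⇒0<n∸m (s≤s t≤M) , ∸-monoʳ-≤ (suc M) 1≤t
    reflect-involutive : ∀ {t} → Inner M t → suc M ∸ (suc M ∸ t) ≡ t
    reflect-involutive (_ , t≤M) = m∸[m∸n]≡n (m≤n⇒m≤1+n t≤M)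
    closed′ : ∀ {w} → ∃[ t ] (Inner M t × path t ≡ w) → ∃[ t ] (Inner M t × path (suc M ∸ t) ≡ w)
    closed′ (t , t-in , eq) = suc M ∸ t , reflect-inner t-in , trans (cong path (reflect-involutive t-in)) eq

  segment⇒ABPiece : ∀ {S a b} (g : ℕ → Fin n) N → IsIndexedPath g N → ∀ t1 t t2 → t1 < t → t < t2 → t2 ≤ N →
                    g t1 ≡ a → g t2 ≡ b → (∀ s → t1 < s → s < t2 → g s ∉ S) →
                    (∀ s w → t1 < s → s < t2 → E G (g s) w → w ∉ S → ∃[ s' ] (t1 < s' × s' < t2 × w ≡ g s')) →
                    ABPiece S a b (g t)
  segment⇒ABPiece {S} g N ip t1 t t2 t1<t t<t2 t2≤N ga gb avoid closed′ = record
    { path     = λ i → g (t1 + i)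
    ; M        = M
    ; indexed  = indexedPath-window g N ip t1 (suc M) (subst (_≤ N) (sym t2≡) t2≤N)
    ; starts   = trans (cong g (+-identityʳ t1)) ga
    ; ends     = trans (cong g t2≡) gb
    ; position = t ∸ t1
    ; inner    = proj₁ (from-window t1<t t<t2)
    ; at-y     = cong g (proj₂ (from-window t1<t t<t2))
    ; avoids   = λ i i-in → avoid _ (proj₁ (to-window i-in)) (proj₂ (to-window i-in))
    ; closed   = closed
    }
    where
    M : ℕ
    M = t2 ∸ suc t1
    t2≡ : t1 + suc M ≡ t2
    t2≡ = trans (+-suc t1 M) (m+[n∸m]≡n (<-trans t1<t t<t2))
    to-window : ∀ {i} → Inner M i → t1 < t1 + i × t1 + i < t2
    to-window {i} (1≤i , i≤M) = m<m+n t1 1≤i , subst (t1 + i <_) t2≡ (+-monoʳ-< t1 (s≤s i≤M))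
    from-window : ∀ {s} → t1 < s → s < t2 → Inner M (s ∸ t1) × t1 + (s ∸ t1) ≡ s
    from-window {s} t1<s s<t2 = (m<n⇒0<n∸m t1<s , ∸-monoˡ-≤ (suc t1) s<t2) ,
                                m+[n∸m]≡n (<⇒≤ t1<s)
    closed : ∀ i w → Inner M i → E G (g (t1 + i)) w → w ∉ S → ∃[ i' ] (Inner M i' × g (t1 + i') ≡ w)
    closed i w i-in e wS with closed′ (t1 + i) w (proj₁ (to-window i-in)) (proj₂ (to-window i-in)) e wS
    ... | s , t1<s , s<t2 , refl = s ∸ t1 , proj₁ (from-window t1<s s<t2) , cong g (proj₂ (from-window t1<s s<t2))

module Modular (k : ℕ) {{_ : NonZero k}} where

  %-absorbˡ : ∀ x z → (x % k + z) % k ≡ (x + z) % k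
  %-absorbˡ x z = begin
    (x % k + z) % k          ≡⟨ %-distribˡ-+ (x % k) z k ⟩
    (x % k % k + z % k) % k  ≡⟨ cong (λ w → (w + z % k) % k) (m%n%n≡m%n x k) ⟩
    (x % k + z % k) % k      ≡⟨ %-distribˡ-+ x z k ⟨
    (x + z) % k              ∎
    where open ≡-Reasoning

  %-absorbʳ : ∀ z x → (z + x % k) % k ≡ (z + x) % k
  %-absorbʳ z x = trans (cong (_% k) (+-comm z (x % k))) (trans (%-absorbˡ x z) (cong (_% k) (+-comm x z)))

  m+[k∸m%k]≡[1+m/k]*k : ∀ m → m + (k ∸ m % k) ≡ suc (m / k) * k
  m+[k∸m%k]≡[1+m/k]*k m = begin
    m + (k ∸ m % k)                     ≡⟨ cong (_+ (k ∸ m % k)) (m≡m%n+[m/n]*n m k) ⟩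
    m % k + (m / k) * k + (k ∸ m % k)   ≡⟨ +-assoc (m % k) _ _ ⟩
    m % k + ((m / k) * k + (k ∸ m % k)) ≡⟨ cong (m % k +_) (+-comm ((m / k) * k) _) ⟩
    m % k + ((k ∸ m % k) + (m / k) * k) ≡⟨ +-assoc (m % k) _ _ ⟨
    (m % k + (k ∸ m % k)) + (m / k) * k ≡⟨ cong (_+ (m / k) * k) (m+[n∸m]≡n (m%n≤n m k)) ⟩
    k + (m / k) * k                     ∎
    where open ≡-Reasoning

  [m+d+[k∸m%k]]%k≡d%k : ∀ m d → (m + d + (k ∸ m % k)) % k ≡ d % k
  [m+d+[k∸m%k]]%k≡d%k m d = begin
    (m + d + (k ∸ m % k)) % k    ≡⟨ cong (_% k) (trans (+-assoc m d _) (trans (cong (m +_) (+-comm d _)) (sym (+-assoc m _ d)))) ⟩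
    (m + (k ∸ m % k) + d) % k    ≡⟨ cong (λ w → (w + d) % k) (m+[k∸m%k]≡[1+m/k]*k m) ⟩
    (suc (m / k) * k + d) % k    ≡⟨ cong (_% k) (+-comm (suc (m / k) * k) d) ⟩
    (d + suc (m / k) * k) % k    ≡⟨ [m+kn]%n≡m%n d (suc (m / k)) k ⟩
    d % k                        ∎
    where open ≡-Reasoning

  offset-injective : ∀ β d d' → d < k → d' < k → (β + d) % k ≡ (β + d') % k → d ≡ d'
  offset-injective β d d' d<k d'<k eq = begin
    d                                  ≡⟨ m<n⇒m%n≡m d<k ⟨
    d % k                              ≡⟨ [m+d+[k∸m%k]]%k≡d%k β d ⟨
    (β + d + (k ∸ β % k)) % k          ≡⟨ %-absorbˡ (β + d) _ ⟨
    ((β + d) % k + (k ∸ β % k)) % k    ≡⟨ cong (λ w → (w + (k ∸ β % k)) % k) eq ⟩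
    ((β + d') % k + (k ∸ β % k)) % k   ≡⟨ %-absorbˡ (β + d') _ ⟩
    (β + d' + (k ∸ β % k)) % k         ≡⟨ [m+d+[k∸m%k]]%k≡d%k β d' ⟩
    d' % k                             ≡⟨ m<n⇒m%n≡m d'<k ⟩
    d'                                 ∎
    where open ≡-Reasoning

  offset-surjective : ∀ β t → ∃[ d ] (d < k × (β + d) % k ≡ t % k)
  offset-surjective β t = d , m%n<n _ k , (begin
    (β + (t + (k ∸ β % k)) % k) % k    ≡⟨ %-absorbʳ β _ ⟩
    (β + (t + (k ∸ β % k))) % k        ≡⟨ cong (_% k) (sym (+-assoc β t _)) ⟩
    (β + t + (k ∸ β % k)) % k          ≡⟨ [m+d+[k∸m%k]]%k≡d%k β t ⟩
    t % k                              ∎)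
    where
    open ≡-Reasoning
    d : ℕ
    d = (t + (k ∸ β % k)) % k

  %-suc-cancel : ∀ a b → suc a % k ≡ suc b % k → a % k ≡ b % k
  %-suc-cancel a b eq = offset-injective 1 (a % k) (b % k) (m%n<n a k) (m%n<n b k)
    (trans (%-absorbʳ 1 a) (trans eq (sym (%-absorbʳ 1 b))))

  offset-successor : ∀ β d d' → d < k → d' < k → suc (β + d) % k ≡ (β + d') % k →
                     suc d ≡ d' ⊎ (suc d ≡ k × d' ≡ 0)
  offset-successor β d d' d<k d'<k eq with m≤n⇒m<n∨m≡n d<k
  ... | inj₁ 1+d<k = inj₁ (offset-injective β (suc d) d' 1+d<k d'<k (trans (cong (_% k) (+-suc β d)) eq))
  ... | inj₂ 1+d≡k = inj₂ (1+d≡k , sym (offset-injective β 0 d' (≤-trans (s≤s z≤n) d<k) d'<k (begin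
    (β + 0) % k        ≡⟨ cong (_% k) (+-identityʳ β) ⟩
    β % k              ≡⟨ [m+n]%n≡m%n β k ⟨
    (β + k) % k        ≡⟨ cong (λ w → (β + w) % k) (sym 1+d≡k) ⟩
    (β + suc d) % k    ≡⟨ cong (_% k) (+-suc β d) ⟩
    suc (β + d) % k    ≡⟨ eq ⟩
    (β + d') % k       ∎)))
    where open ≡-Reasoning

  -- distance from s to x going forward around the cycle
  offset : ℕ → ℕ → ℕ
  offset s x = (x + (k ∸ s)) % k

  offset-shift : ∀ β d s → ((β + d) % k + (k ∸ s)) % k ≡ ((β + (k ∸ s)) % k + d) % k
  offset-shift β d s = trans (%-absorbˡ (β + d) (k ∸ s)) (trans (cong (_% k) eq) (sym (%-absorbˡ (β + (k ∸ s)) d)))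
    where
    eq : β + d + (k ∸ s) ≡ β + (k ∸ s) + d
    eq = trans (+-assoc β d _) (trans (cong (β +_) (+-comm d _)) (sym (+-assoc β _ d)))

  private
    forward : ∀ s x → s ≤ x → s ≤ k → x + (k ∸ s) ≡ (x ∸ s) + k
    forward s x s≤x s≤k = begin
      x + (k ∸ s)              ≡⟨ cong (_+ (k ∸ s)) (m∸n+n≡m s≤x) ⟨
      (x ∸ s) + s + (k ∸ s)    ≡⟨ +-assoc (x ∸ s) s _ ⟩
      (x ∸ s) + (s + (k ∸ s))  ≡⟨ cong ((x ∸ s) +_) (m+[n∸m]≡n s≤k) ⟩
      (x ∸ s) + k              ∎
      where open ≡-Reasoning

    offset-forward : ∀ s x → s ≤ x → s < k → x < k → offset s x ≡ x ∸ s
    offset-forward s x s≤x s<k x<k =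
      trans (cong (_% k) (forward s x s≤x (<⇒≤ s<k)))
            (trans ([m+n]%n≡m%n (x ∸ s) k) (m<n⇒m%n≡m (≤-<-trans (m∸n≤m x s) x<k)))

    wrap : ∀ s x → x < s → s < k → x + (k ∸ s) < k
    wrap s x x<s s<k = subst (x + (k ∸ s) <_) (m+[n∸m]≡n (<⇒≤ s<k)) (+-monoˡ-< (k ∸ s) x<s)

    unwrap : ∀ s x → s < k → x + (k ∸ s) + s ≡ x + k
    unwrap s x s<k = trans (+-assoc x (k ∸ s) s) (cong (x +_) (m∸n+n≡m (<⇒≤ s<k)))

  in-interval⇒offset< : ∀ s x m → s < k → x < k → m ≤ k →
                        (s ≤ x × x < s + m) ⊎ (x + k < s + m) → offset s x < m
  in-interval⇒offset< s x m s<k x<k m≤k (inj₁ (s≤x , x<s+m)) =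
    subst (_< m) (sym (offset-forward s x s≤x s<k x<k)) (subst (x ∸ s <_) (m+n∸m≡n s m) (∸-monoˡ-< x<s+m s≤x))
  in-interval⇒offset< s x m s<k x<k m≤k (inj₂ x+k<s+m) =
    subst (_< m) (sym (m<n⇒m%n≡m (wrap s x x<s s<k)))
      (+-cancelʳ-< s (x + (k ∸ s)) m (subst₂ _<_ (sym (unwrap s x s<k)) (+-comm s m) x+k<s+m))
    where
    x<s : x < s
    x<s = +-cancelʳ-< k x s (<-≤-trans x+k<s+m (+-monoʳ-≤ s m≤k))

  offset<⇒in-interval : ∀ s x m → s < k → x < k → offset s x < m → (s ≤ x × x < s + m) ⊎ (x + k < s + m)
  offset<⇒in-interval s x m s<k x<k off<m with s ≤? x
  ... | yes s≤x = inj₁ (s≤x , subst₂ _<_ (m∸n+n≡m s≤x) (+-comm m s)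
                                (+-monoˡ-< s (subst (_< m) (offset-forward s x s≤x s<k x<k) off<m)))
  ... | no s≰x = inj₂ (subst₂ _<_ (unwrap s x s<k) (+-comm m s)
                        (+-monoˡ-< s (subst (_< m) (m<n⇒m%n≡m (wrap s x (≰⇒> s≰x) s<k)) off<m)))

  -- u, u + d1, u + q, u + d2 lie in this cyclic order, so an interval [0, m) of ℤ/k containing
  -- u + d1 and u + d2 contains u or u + q
  cyclic-interval-convex : ∀ u m d1 q d2 → u < k → 0 < d1 → d1 < q → q < d2 → d2 < k →
                           (u + d1) % k < m → (u + d2) % k < m → ¬ ((u + 0) % k < m) → ¬ ((u + q) % k < m) → ⊥
  cyclic-interval-convex u m d1 q d2 u<k 0<d1 d1<q q<d2 d2<k in1 in2 out0 outq with (u + d1) <? k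
  ... | yes u+d1<k = out0 (subst (_< m) (sym (trans (cong (_% k) (+-identityʳ u)) (m<n⇒m%n≡m u<k)))
                         (≤-<-trans (m≤m+n u d1) (subst (_< m) (m<n⇒m%n≡m u+d1<k) in1)))
  ... | no u+d1≮k = outq (subst (_< m) (sym (%-once (u + q) k≤u+q (+-mono-< u<k (<-trans q<d2 d2<k))))
                      (<-trans (∸-monoˡ-< (+-monoʳ-< u q<d2) k≤u+q)
                               (subst (_< m) (%-once (u + d2) k≤u+d2 (+-mono-< u<k d2<k)) in2)))
    where
    %-once : ∀ x → k ≤ x → x < k + k → x % k ≡ x ∸ k
    %-once x k≤x x<2k = trans (sym (m≤n⇒[n∸m]%m≡n%m k≤x)) (m<n⇒m%n≡m (subst (x ∸ k <_) (m+n∸m≡n k k) (∸-monoˡ-< x<2k k≤x)))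
    k≤u+q : k ≤ u + q
    k≤u+q = ≤-trans (≮⇒≥ u+d1≮k) (+-monoʳ-≤ u (<⇒≤ d1<q))
    k≤u+d2 : k ≤ u + d2
    k≤u+d2 = ≤-trans k≤u+q (+-monoʳ-≤ u (<⇒≤ q<d2))


module ListIndexing {A : Set} where

  nth : A → List A → ℕ → A
  nth d [] _ = d
  nth d (x ∷ xs) zero = x
  nth d (x ∷ xs) (suc t) = nth d xs t

  lookup≡nth : ∀ d (L : List A) (p : Fin (length L)) → lookup L p ≡ nth d L (toℕ p)
  lookup≡nth d (x ∷ L) Fin.zero = refl
  lookup≡nth d (x ∷ L) (Fin.suc p) = lookup≡nth d L p

  nth≡lookup : ∀ d (L : List A) s (s<len : s < length L) → nth d L s ≡ lookup L (fromℕ< s<len)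
  nth≡lookup d L s s<len = trans (cong (nth d L) (sym (toℕ-fromℕ< s<len))) (sym (lookup≡nth d L (fromℕ< s<len)))

  nth-∈ : ∀ d (L : List A) s → s < length L → nth d L s ∈L L
  nth-∈ d (x ∷ L) zero _ = here refl
  nth-∈ d (x ∷ L) (suc s) (s≤s s<len) = there (nth-∈ d L s s<len)

  ∈⇒nth : ∀ d {L : List A} {v} → v ∈L L → ∃[ s ] (s < length L × v ≡ nth d L s)
  ∈⇒nth d (here refl) = 0 , s≤s z≤n , refl
  ∈⇒nth d (there v∈) with ∈⇒nth d v∈
  ... | s , s<len , eq = suc s , s≤s s<len , eq

  nth-injective : ∀ d (L : List A) → Unique L → ∀ s s' → s < length L → s' < length L →
                  nth d L s ≡ nth d L s' → s ≡ s'
  nth-injective d (x ∷ L) (_ ∷ _) zero zero _ _ _ = refl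
  nth-injective d (x ∷ L) (x∉ ∷ _) zero (suc s') _ (s≤s l') eq = ⊥-elim (All-lookup x∉ (nth-∈ d L s' l') eq)
  nth-injective d (x ∷ L) (x∉ ∷ _) (suc s) zero (s≤s l) _ eq = ⊥-elim (All-lookup x∉ (nth-∈ d L s l) (sym eq))
  nth-injective d (x ∷ L) (_ ∷ u) (suc s) (suc s') (s≤s l) (s≤s l') eq = cong suc (nth-injective d L u s s' l l' eq)

  nth-++-prefix : ∀ d (I : List A) y z s → s ≤ length I → nth d (I ++ y ∷ z ∷ []) s ≡ nth d (I ++ y ∷ []) s
  nth-++-prefix d [] y z zero _ = refl
  nth-++-prefix d (x ∷ I) y z zero _ = refl
  nth-++-prefix d (x ∷ I) y z (suc s) (s≤s s≤len) = nth-++-prefix d I y z s s≤len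

  nth-last : ∀ d (I : List A) y → nth d (I ++ y ∷ []) (length I) ≡ y
  nth-last d [] y = refl
  nth-last d (x ∷ I) y = nth-last d I y

  nth-last₂ : ∀ d (I : List A) y z → nth d (I ++ y ∷ z ∷ []) (suc (length I)) ≡ z
  nth-last₂ d [] y z = refl
  nth-last₂ d (x ∷ I) y z = nth-last₂ d I y z

  ∈-prefix⇒nth : ∀ d {I : List A} y {v} → v ∈L I → ∃[ s ] (s < length I × v ≡ nth d (I ++ y ∷ []) s)
  ∈-prefix⇒nth d y (here refl) = 0 , s≤s z≤n , refl
  ∈-prefix⇒nth d y (there v∈) with ∈-prefix⇒nth d y v∈
  ... | s , s<len , eq = suc s , s≤s s<len , eq

  length-∷ʳ : ∀ (I : List A) y → length (I ++ y ∷ []) ≡ suc (length I)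
  length-∷ʳ I y = trans (length-++ I) (+-comm (length I) 1)

module _ {n : ℕ} (G : Graph n) where
  open ListIndexing

  IsPath-nth : ∀ d (L : List (Fin n)) → IsPath G L → ∀ s s' → s < length L → s' < length L →
               E G (nth d L s) (nth d L s') ⇔ (suc s ≡ s' ⊎ suc s' ≡ s)
  IsPath-nth d L (_ , adjacency) s s' l l' rewrite nth≡lookup d L s l | nth≡lookup d L s' l'
    with adjacency (fromℕ< l) (fromℕ< l')
  ... | adjacency-at rewrite toℕ-fromℕ< l | toℕ-fromℕ< l' = adjacency-at

module HoleCoordinates {n : ℕ} (G : Graph n) {k : ℕ} (c : Fin k → Fin n) (hole : IsHole G k c) where
  open Walks G
  open IndexedPaths G

  4≤k : 4 ≤ k
  4≤k = proj₁ hole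

  0<k : 0 < k
  0<k = ≤-trans (s≤s z≤n) 4≤k

  1≤k : 1 ≤ k
  1≤k = 0<k

  1<k : 1 < k
  1<k = ≤-trans (s≤s (s≤s z≤n)) 4≤k

  2<k : 2 < k
  2<k = ≤-trans (s≤s (s≤s (s≤s z≤n))) 4≤k

  instance
    k-nonZero : NonZero k
    k-nonZero = >-nonZero 0<k

  open Modular k public

  c-injective : ∀ i j → c i ≡ c j → i ≡ j
  c-injective = proj₁ (proj₂ hole)

  c-adjacent : ∀ i j → E G (c i) (c j) ⇔ (CycNext k i j ⊎ CycNext k j i)
  c-adjacent = proj₂ (proj₂ hole)

  cyc : ℕ → Fin n
  cyc t = c (t mod k)

  toℕ-mod : ∀ t → toℕ (t mod k) ≡ t % k
  toℕ-mod t = toℕ-fromℕ< _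

  cyc-≡⇒%-≡ : ∀ t t' → cyc t ≡ cyc t' → t % k ≡ t' % k
  cyc-≡⇒%-≡ t t' eq = trans (sym (toℕ-mod t)) (trans (cong toℕ (c-injective _ _ eq)) (toℕ-mod t'))

  %-≡⇒cyc-≡ : ∀ t t' → t % k ≡ t' % k → cyc t ≡ cyc t'
  %-≡⇒cyc-≡ t t' eq = cong c (toℕ-injective (trans (toℕ-mod t) (trans eq (sym (toℕ-mod t')))))

  c≡cyc : ∀ j → c j ≡ cyc (toℕ j)
  c≡cyc j = cong c (toℕ-injective (sym (trans (toℕ-mod (toℕ j)) (m<n⇒m%n≡m (toℕ<n j)))))

  cyc-periodic : ∀ t → cyc (t + k) ≡ cyc t
  cyc-periodic t = %-≡⇒cyc-≡ _ _ ([m+n]%n≡m%n t k)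

  cyc-+0 : ∀ β → cyc (β + 0) ≡ cyc β
  cyc-+0 β = cong cyc (+-identityʳ β)

  cyc-suc : ∀ x y → cyc x ≡ cyc y → cyc (suc x) ≡ cyc (suc y)
  cyc-suc x y eq = %-≡⇒cyc-≡ _ _ (trans (sym (%-absorbʳ 1 x)) (trans (cong (λ w → (1 + w) % k) (cyc-≡⇒%-≡ x y eq)) (%-absorbʳ 1 y)))

  cyc-pred : ∀ x y → cyc (suc x) ≡ cyc (suc y) → cyc x ≡ cyc y
  cyc-pred x y eq = %-≡⇒cyc-≡ _ _ (%-suc-cancel x y (cyc-≡⇒%-≡ _ _ eq))

  CycNext⇒% : ∀ i j → CycNext k i j → suc (toℕ i) % k ≡ toℕ j
  CycNext⇒% i j (inj₁ eq) = trans (m<n⇒m%n≡m (subst (_< k) (sym eq) (toℕ<n j))) eq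
  CycNext⇒% i j (inj₂ (1+i≡k , j≡0)) = trans (cong (_% k) 1+i≡k) (trans (n%n≡0 k) (sym j≡0))

  %⇒CycNext : ∀ i j → suc (toℕ i) % k ≡ toℕ j → CycNext k i j
  %⇒CycNext i j eq with m≤n⇒m<n∨m≡n (toℕ<n i)
  ... | inj₁ 1+i<k = inj₁ (trans (sym (m<n⇒m%n≡m 1+i<k)) eq)
  ... | inj₂ 1+i≡k = inj₂ (1+i≡k , trans (sym eq) (trans (cong (_% k) 1+i≡k) (n%n≡0 k)))

  cyc-adjacent : ∀ t → E G (cyc t) (cyc (suc t))
  cyc-adjacent t = Equivalence.from (c-adjacent _ _) (inj₁ (%⇒CycNext _ _
    (trans (cong (λ w → suc w % k) (toℕ-mod t)) (trans (%-absorbʳ 1 t) (sym (toℕ-mod (suc t)))))))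

  private
    next⇒successor : ∀ t t' → CycNext k (t mod k) (t' mod k) → suc t % k ≡ t' % k
    next⇒successor t t' next = trans (sym (%-absorbʳ 1 t))
      (trans (cong (λ w → suc w % k) (sym (toℕ-mod t))) (trans (CycNext⇒% _ _ next) (toℕ-mod t')))

  cyc-adjacent⇒successor : ∀ t t' → E G (cyc t) (cyc t') → suc t % k ≡ t' % k ⊎ suc t' % k ≡ t % k
  cyc-adjacent⇒successor t t' e with Equivalence.to (c-adjacent _ _) e
  ... | inj₁ next = inj₁ (next⇒successor t t' next)
  ... | inj₂ next = inj₂ (next⇒successor t' t next)

  cyc-offset : ∀ β t → ∃[ d ] (d < k × cyc t ≡ cyc (β + d))
  cyc-offset β t with offset-surjective β t
  ... | d , d<k , eq = d , d<k , %-≡⇒cyc-≡ _ _ (sym eq)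

  c-offset : ∀ β j → ∃[ d ] (d < k × c j ≡ cyc (β + d))
  c-offset β j with cyc-offset β (toℕ j)
  ... | d , d<k , eq = d , d<k , trans (c≡cyc j) eq

  cyc-offset-injective : ∀ β d d' → d < k → d' < k → cyc (β + d) ≡ cyc (β + d') → d ≡ d'
  cyc-offset-injective β d d' d<k d'<k eq = offset-injective β d d' d<k d'<k (cyc-≡⇒%-≡ _ _ eq)

  Follows : ℕ → ℕ → Set
  Follows d d' = suc d ≡ d' ⊎ (suc d ≡ k × d' ≡ 0)

  cyc-offset-adjacent : ∀ β d d' → d < k → d' < k → E G (cyc (β + d)) (cyc (β + d')) → Follows d d' ⊎ Follows d' d
  cyc-offset-adjacent β d d' d<k d'<k e with cyc-adjacent⇒successor _ _ e
  ... | inj₁ eq = inj₁ (offset-successor β d d' d<k d'<k eq)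
  ... | inj₂ eq = inj₂ (offset-successor β d' d d'<k d<k eq)

  cyc-+2-≢ : ∀ β → cyc (β + 0) ≢ cyc (β + 2)
  cyc-+2-≢ β eq with cyc-offset-injective β 0 2 0<k 2<k eq
  ... | ()

  cyc-≢-suc : ∀ t → cyc t ≢ cyc (suc t)
  cyc-≢-suc t eq with cyc-offset-injective t 0 1 0<k 1<k (trans (cong cyc (+-identityʳ t)) (trans eq (cong cyc (+-comm 1 t))))
  ... | ()

  cyc-+2-nonadjacent : ∀ β → ¬ E G (cyc (β + 0)) (cyc (β + 2))
  cyc-+2-nonadjacent β e with cyc-offset-adjacent β 0 2 0<k 2<k e
  ... | inj₁ (inj₁ ())
  ... | inj₁ (inj₂ (_ , ()))
  ... | inj₂ (inj₁ ())
  ... | inj₂ (inj₂ (3≡k , _)) = <-irrefl 3≡k 4≤k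

  cyc-back : ∀ β d → cyc (β + (k ∸ 1) + suc d) ≡ cyc (β + d)
  cyc-back β d = trans (cong cyc eq) (cyc-periodic (β + d))
    where
    eq : β + (k ∸ 1) + suc d ≡ β + d + k
    eq = begin
      β + (k ∸ 1) + suc d    ≡⟨ +-assoc β (k ∸ 1) (suc d) ⟩
      β + ((k ∸ 1) + suc d)  ≡⟨ cong (β +_) (+-suc (k ∸ 1) d) ⟩
      β + (suc (k ∸ 1) + d)  ≡⟨ cong (λ z → β + (z + d)) (m+[n∸m]≡n 1≤k) ⟩
      β + (k + d)            ≡⟨ cong (β +_) (+-comm k d) ⟩
      β + (d + k)            ≡⟨ +-assoc β d k ⟨
      β + d + k              ∎
      where open ≡-Reasoning

  cyc-back₁ : ∀ β → cyc (β + (k ∸ 1) + 1) ≡ cyc β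
  cyc-back₁ β = trans (cyc-back β 0) (cyc-+0 β)

  cyc-−1-adjacent : ∀ β → E G (cyc (β + (k ∸ 1))) (cyc β)
  cyc-−1-adjacent β = subst (E G (cyc (β + (k ∸ 1)))) (trans (cong cyc (+-comm 1 _)) (cyc-back₁ β))
                            (cyc-adjacent (β + (k ∸ 1)))

  cyc-+1-adjacent : ∀ β → E G (cyc β) (cyc (β + 1))
  cyc-+1-adjacent β = subst (λ z → E G (cyc β) (cyc z)) (+-comm 1 β) (cyc-adjacent β)

  k∸1<k : k ∸ 1 < k
  k∸1<k = ∸-monoʳ-< {k} {1} {0} (s≤s z≤n) 1≤k

  cyc-neighbours-≢ : ∀ β → cyc (β + 1) ≢ cyc (β + (k ∸ 1))
  cyc-neighbours-≢ β eq with cyc-offset-injective β 1 (k ∸ 1) 1<k k∸1<k eq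
  ... | 1≡k∸1 = <-irrefl (trans (cong suc 1≡k∸1) (m+[n∸m]≡n 1≤k)) 2<k

  cyc-neighbours-nonadjacent : ∀ β → ¬ E G (cyc (β + 1)) (cyc (β + (k ∸ 1)))
  cyc-neighbours-nonadjacent β e with cyc-offset-adjacent β 1 (k ∸ 1) 1<k k∸1<k e
  ... | inj₁ (inj₁ 2≡k∸1) = <-irrefl (trans (cong suc 2≡k∸1) (m+[n∸m]≡n 1≤k)) 4≤k
  ... | inj₁ (inj₂ (2≡k , _)) = <-irrefl 2≡k 2<k
  ... | inj₂ (inj₁ k≡1) = <-irrefl (sym (trans (sym (m+[n∸m]≡n 1≤k)) k≡1)) 1<k
  ... | inj₂ (inj₂ (_ , ()))

  cyc-neighbours : ∀ β t → E G (cyc β) (cyc t) → cyc t ≡ cyc (β + 1) ⊎ cyc t ≡ cyc (β + (k ∸ 1))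
  cyc-neighbours β t e with cyc-offset β t
  ... | d , d<k , eq with cyc-offset-adjacent β 0 d 0<k d<k (subst₂ (E G) (sym (cyc-+0 β)) eq e)
  ...   | inj₁ (inj₁ refl) = inj₁ eq
  ...   | inj₁ (inj₂ (1≡k , _)) = ⊥-elim (<-irrefl 1≡k 1<k)
  ...   | inj₂ (inj₁ ())
  ...   | inj₂ (inj₂ (1+d≡k , _)) = inj₂ (trans eq (cong (λ z → cyc (β + z)) (cong (_∸ 1) 1+d≡k)))

  cyc-triangle-free : ∀ β t1 t2 → E G (cyc β) (cyc t1) → E G (cyc β) (cyc t2) → ¬ E G (cyc t1) (cyc t2)
  cyc-triangle-free β t1 t2 e1 e2 e12 with cyc-neighbours β t1 e1 | cyc-neighbours β t2 e2
  ... | inj₁ x | inj₁ y = E-irrefl (subst₂ (E G) x y e12)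
  ... | inj₂ x | inj₂ y = E-irrefl (subst₂ (E G) x y e12)
  ... | inj₁ x | inj₂ y = cyc-neighbours-nonadjacent β (subst₂ (E G) x y e12)
  ... | inj₂ x | inj₁ y = cyc-neighbours-nonadjacent β (E-sym (subst₂ (E G) x y e12))

  arc-indexedPath : ∀ β M → M + 2 ≤ k → IsIndexedPath (λ x → cyc (β + x)) M
  arc-indexedPath β M M+2≤k = record
    { injective = λ t t' t≤M t'≤M → cyc-offset-injective β t t' (below t≤M) (below t'≤M)
    ; adjacent⇒consecutive = adjacent
    ; consecutive-adjacent = λ t _ → subst (λ z → E G (cyc (β + t)) (cyc z)) (sym (+-suc β t)) (cyc-adjacent (β + t))
    }
    where
    2+M≤k : suc (suc M) ≤ k
    2+M≤k = ≤-trans (≤-reflexive (+-comm 2 M)) M+2≤k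
    below : ∀ {x} → x ≤ M → x < k
    below x≤M = ≤-<-trans x≤M (≤-trans (n≤1+n (suc M)) 2+M≤k)
    no-wrap : ∀ {x} → x ≤ M → suc x ≢ k
    no-wrap x≤M 1+x≡k = <-irrefl 1+x≡k (≤-trans (s≤s (s≤s x≤M)) 2+M≤k)
    adjacent : ∀ t t' → t ≤ M → t' ≤ M → E G (cyc (β + t)) (cyc (β + t')) → suc t ≡ t' ⊎ suc t' ≡ t
    adjacent t t' t≤M t'≤M e with cyc-offset-adjacent β t t' (below t≤M) (below t'≤M) e
    ... | inj₁ (inj₁ eq) = inj₁ eq
    ... | inj₁ (inj₂ (1+t≡k , _)) = ⊥-elim (no-wrap t≤M 1+t≡k)
    ... | inj₂ (inj₁ eq) = inj₂ eq
    ... | inj₂ (inj₂ (1+t'≡k , _)) = ⊥-elim (no-wrap t'≤M 1+t'≡k)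

module Petals {n : ℕ} (G : Graph n) (D : IsDaisy G) where
  open Walks G
  open IndexedPaths G
  open ListIndexing
  open IsDaisy D
  open HoleCoordinates G c hole public

  record PetalAt : Set where
    constructor petalAt
    field
      centre : Fin k
      px     : Fin n
      pI     : List (Fin n)
      py     : Fin n
      listed : petals centre ≡ just (petal px pI py)

  -- The petal x I y with centre c_i is extended by the hole vertices c_{i-1}, c_{i+1} to an induced
  -- path ext 0 = c_{i-1}, ext 1 = x, …, ext len = y, ext N = c_{i+1}; c_{i-1} is cyc ℓ.
  module PetalPath (p : PetalAt) where
    open PetalAt p

    ℓ : ℕ
    ℓ = toℕ centre + (k ∸ 1)

    suc-ℓ%k : suc ℓ % k ≡ toℕ centre
    suc-ℓ%k = trans (cong (_% k) (trans (sym (+-suc (toℕ centre) (k ∸ 1))) (cong (toℕ centre +_) (m+[n∸m]≡n 1≤k))))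
                    (trans ([m+n]%n≡m%n (toℕ centre) k) (m<n⇒m%n≡m (toℕ<n centre)))

    centre≡cyc : c centre ≡ cyc (suc ℓ)
    centre≡cyc = trans (c≡cyc centre) (%-≡⇒cyc-≡ _ _ (trans (m<n⇒m%n≡m (toℕ<n centre)) (sym suc-ℓ%k)))

    suc-centre%k : suc (toℕ centre) % k ≡ suc (suc ℓ) % k
    suc-centre%k = trans (cong (λ w → suc w % k) (sym suc-ℓ%k)) (%-absorbʳ 1 (suc ℓ))

    left right : Fin k
    left = ℓ mod k
    right = suc (suc ℓ) mod k

    left-next : CycNext k left centre
    left-next = %⇒CycNext left centre (trans (cong (λ w → suc w % k) (toℕ-mod ℓ)) (trans (%-absorbʳ 1 ℓ) suc-ℓ%k))

    right-next : CycNext k centre right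
    right-next = %⇒CycNext centre right (trans suc-centre%k (sym (toℕ-mod (suc (suc ℓ)))))

    left-unique : ∀ j → CycNext k j centre → c j ≡ cyc ℓ
    left-unique j next = trans (c≡cyc j) (%-≡⇒cyc-≡ _ _ (%-suc-cancel (toℕ j) ℓ (trans (CycNext⇒% j centre next) (sym suc-ℓ%k))))

    right-unique : ∀ j → CycNext k centre j → c j ≡ cyc (suc (suc ℓ))
    right-unique j next = trans (c≡cyc j)
      (%-≡⇒cyc-≡ _ _ (trans (m<n⇒m%n≡m (toℕ<n j)) (trans (sym (CycNext⇒% centre j next)) suc-centre%k)))

    L : List (Fin n)
    L = px ∷ pI ++ py ∷ []

    extended : List (Fin n)
    extended = cyc ℓ ∷ px ∷ pI ++ py ∷ cyc (suc (suc ℓ)) ∷ []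

    ext : ℕ → Fin n
    ext = nth (cyc ℓ) extended

    len : ℕ
    len = suc (suc (length pI))

    N : ℕ
    N = suc len

    length-L : length L ≡ len
    length-L = cong suc (length-∷ʳ pI py)

    private
      isPetal : IsPetal G k c centre (petal px pI py)
      isPetal = petalOK centre (petal px pI py) listed

    L-isPath : IsPath G L
    L-isPath = proj₁ isPetal

    L-off-hole : ∀ v → v ∈L L → ∀ j → c j ≢ v
    L-off-hole = proj₁ (proj₂ isPetal)

    x-adjacent-left : ∀ j → CycNext k j centre → E G px (c j)
    x-adjacent-left = proj₁ (proj₂ (proj₂ isPetal))

    y-adjacent-right : ∀ j → CycNext k centre j → E G py (c j)
    y-adjacent-right = proj₁ (proj₂ (proj₂ (proj₂ isPetal)))

    has-spoke : ∃[ v ] (v ∈L pI × E G v (c centre))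
    has-spoke = proj₁ (proj₂ (proj₂ (proj₂ (proj₂ isPetal))))

    no-edge-both-adjacent : ∀ j j' → CycNext k j centre → CycNext k centre j' →
                            NoEdgeBothAdj G (c centre) (c j ∷ px ∷ pI ++ py ∷ c j' ∷ [])
    no-edge-both-adjacent = proj₁ (proj₂ (proj₂ (proj₂ (proj₂ (proj₂ isPetal)))))

    L-hole-edges : ∀ v j → v ∈L L → E G v (c j) →
                   (CycNext k j centre × v ≡ px) ⊎ (CycNext k centre j × v ≡ py) ⊎ (j ≡ centre × v ∈L pI)
    L-hole-edges = proj₂ (proj₂ (proj₂ (proj₂ (proj₂ (proj₂ isPetal)))))

    ext-inner : ∀ s → s < len → ext (suc s) ≡ nth (cyc ℓ) L s
    ext-inner zero _ = refl
    ext-inner (suc s) (s≤s s<) = nth-++-prefix (cyc ℓ) pI py (cyc (suc (suc ℓ))) s (≤-pred s<)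

    ext-N : ext N ≡ cyc (suc (suc ℓ))
    ext-N = nth-last₂ (cyc ℓ) pI py (cyc (suc (suc ℓ)))

    ext-len : ext len ≡ py
    ext-len = trans (ext-inner (suc (length pI)) ≤-refl) (nth-last (cyc ℓ) pI py)

    private
      below-length : ∀ {s} → s < len → s < length L
      below-length {s} s< = subst (s <_) (sym length-L) s<

    ext-inner-∈ : ∀ s → s < len → ext (suc s) ∈L L
    ext-inner-∈ s s< = subst (_∈L L) (sym (ext-inner s s<)) (nth-∈ (cyc ℓ) L s (below-length s<))

    ∈L⇒ext-inner : ∀ v → v ∈L L → ∃[ s ] (s < len × v ≡ ext (suc s))
    ∈L⇒ext-inner v v∈ with ∈⇒nth (cyc ℓ) v∈
    ... | s , s< , eq = s , subst (s <_) length-L s< , trans eq (sym (ext-inner s (subst (s <_) length-L s<)))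

    inner-off-hole : ∀ s → s < len → ∀ j → c j ≢ ext (suc s)
    inner-off-hole s s< j = L-off-hole _ (ext-inner-∈ s s<) j

    inner-injective : ∀ s s' → s < len → s' < len → ext (suc s) ≡ ext (suc s') → s ≡ s'
    inner-injective s s' l l' eq = nth-injective (cyc ℓ) L (proj₁ L-isPath) s s' (below-length l) (below-length l')
       (trans (sym (ext-inner s l)) (trans eq (ext-inner s' l')))

    inner-adjacent : ∀ s s' → s < len → s' < len → E G (ext (suc s)) (ext (suc s')) ⇔ (suc s ≡ s' ⊎ suc s' ≡ s)
    inner-adjacent s s' l l' rewrite ext-inner s l | ext-inner s' l' =
      IsPath-nth G (cyc ℓ) L L-isPath s s' (below-length l) (below-length l')

    data Position : ℕ → Set where
      at-left  : Position 0
      at-inner : ∀ s → s < len → Position (suc s)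
      at-right : Position N

    position : ∀ t → t ≤ N → Position t
    position zero _ = at-left
    position (suc s) s≤ with m≤n⇒m<n∨m≡n s≤
    ... | inj₁ s< = at-inner s (≤-pred s<)
    ... | inj₂ refl = at-right

    left≢right : cyc ℓ ≢ cyc (suc (suc ℓ))
    left≢right eq = cyc-+2-≢ ℓ (trans (cong cyc (+-identityʳ ℓ)) (trans eq (cong cyc (+-comm 2 ℓ))))

    left-right-nonadjacent : ¬ E G (cyc ℓ) (cyc (suc (suc ℓ)))
    left-right-nonadjacent adj = cyc-+2-nonadjacent ℓ (subst₂ (λ a b → E G (cyc a) (cyc b)) (sym (+-identityʳ ℓ)) (+-comm 2 ℓ) adj)

    left-adjacent-inner⇒first : ∀ s → s < len → E G (cyc ℓ) (ext (suc s)) → s ≡ 0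
    left-adjacent-inner⇒first s s< adj with L-hole-edges (ext (suc s)) left (ext-inner-∈ s s<) (E-sym adj)
    ... | inj₁ (_ , eq) = inner-injective s 0 s< (s≤s z≤n) eq
    ... | inj₂ (inj₁ (next , _)) = ⊥-elim (left≢right (right-unique left next))
    ... | inj₂ (inj₂ (eq , _)) = ⊥-elim (cyc-≢-suc ℓ (trans (cong c eq) centre≡cyc))

    inner-adjacent-right⇒last : ∀ s → s < len → E G (ext (suc s)) (cyc (suc (suc ℓ))) → suc s ≡ len
    inner-adjacent-right⇒last s s< adj with L-hole-edges (ext (suc s)) right (ext-inner-∈ s s<) adj
    ... | inj₁ (next , _) = ⊥-elim (left≢right (sym (left-unique right next)))
    ... | inj₂ (inj₁ (_ , eq)) = cong suc (inner-injective s (suc (length pI)) s< ≤-refl (trans eq (sym ext-len)))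
    ... | inj₂ (inj₂ (eq , _)) = ⊥-elim (cyc-≢-suc (suc ℓ) (sym (trans (cong c eq) centre≡cyc)))

    ext-indexedPath : IsIndexedPath ext N
    ext-indexedPath = record
      { injective = injective′ ; adjacent⇒consecutive = adjacent ; consecutive-adjacent = consecutive }
      where
      injective′ : ∀ t t' → t ≤ N → t' ≤ N → ext t ≡ ext t' → t ≡ t'
      injective′ t t' t≤ t'≤ eq with position t t≤ | position t' t'≤
      ... | at-left      | at-left       = refl
      ... | at-left      | at-inner s' l' = ⊥-elim (inner-off-hole s' l' left eq)
      ... | at-left      | at-right      = ⊥-elim (left≢right (trans eq ext-N))
      ... | at-inner s l | at-left       = ⊥-elim (inner-off-hole s l left (sym eq))
      ... | at-inner s l | at-inner s' l' = cong suc (inner-injective s s' l l' eq)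
      ... | at-inner s l | at-right      = ⊥-elim (inner-off-hole s l right (sym (trans eq ext-N)))
      ... | at-right     | at-left       = ⊥-elim (left≢right (trans (sym eq) ext-N))
      ... | at-right     | at-inner s' l' = ⊥-elim (inner-off-hole s' l' right (trans (sym ext-N) eq))
      ... | at-right     | at-right      = refl
      adjacent : ∀ t t' → t ≤ N → t' ≤ N → E G (ext t) (ext t') → suc t ≡ t' ⊎ suc t' ≡ t
      adjacent t t' t≤ t'≤ adj with position t t≤ | position t' t'≤
      ... | at-left      | at-left        = ⊥-elim (E-irrefl adj)
      ... | at-left      | at-inner s' l' = inj₁ (cong suc (sym (left-adjacent-inner⇒first s' l' adj)))
      ... | at-left      | at-right       = ⊥-elim (left-right-nonadjacent (subst (E G (cyc ℓ)) ext-N adj))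
      ... | at-inner s l | at-left        = inj₂ (cong suc (sym (left-adjacent-inner⇒first s l (E-sym adj))))
      ... | at-inner s l | at-inner s' l' = Sum.map (cong suc) (cong suc) (Equivalence.to (inner-adjacent s s' l l') adj)
      ... | at-inner s l | at-right       = inj₁ (cong suc (inner-adjacent-right⇒last s l (subst (E G (ext (suc s))) ext-N adj)))
      ... | at-right     | at-left        = ⊥-elim (left-right-nonadjacent (E-sym (subst (λ z → E G z (cyc ℓ)) ext-N adj)))
      ... | at-right     | at-inner s' l' = inj₂ (cong suc (inner-adjacent-right⇒last s' l' (E-sym (subst (λ z → E G z (ext (suc s'))) ext-N adj))))
      ... | at-right     | at-right       = ⊥-elim (E-irrefl adj)
      consecutive : ∀ t → t < N → E G (ext t) (ext (suc t))
      consecutive zero _ = E-sym (x-adjacent-left left left-next)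
      consecutive (suc s) s< with m≤n⇒m<n∨m≡n s<
      ... | inj₁ 1+s<len = Equivalence.from (inner-adjacent s (suc s) (≤-pred s<) (≤-pred 1+s<len)) (inj₁ refl)
      ... | inj₂ refl = subst (E G (ext len)) (sym ext-N)
                          (subst (λ z → E G z (cyc (suc (suc ℓ)))) (sym ext-len) (y-adjacent-right right right-next))

    no-edge-both-adjacent-centre : ∀ t → t < N → ¬ (E G (ext t) (cyc (suc ℓ)) × E G (ext (suc t)) (cyc (suc ℓ)))
    no-edge-both-adjacent-centre t t<N (adj₁ , adj₂) =
      no-edge-both-adjacent left right left-next right-next (fromℕ< l1) (fromℕ< l2)
        (trans (cong suc (toℕ-fromℕ< l1)) (sym (toℕ-fromℕ< l2)))
        (subst₂ (E G) (nth≡lookup (cyc ℓ) extended t l1) (nth≡lookup (cyc ℓ) extended (suc t) l2)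
          (consecutive-adjacent ext-indexedPath t t<N))
        (subst₂ (E G) (nth≡lookup (cyc ℓ) extended t l1) (sym centre≡cyc) adj₁ ,
         subst₂ (E G) (nth≡lookup (cyc ℓ) extended (suc t) l2) (sym centre≡cyc) adj₂)
      where
      length-extended : length extended ≡ suc N
      length-extended = cong (λ z → suc (suc z)) (trans (length-++ pI) (+-comm (length pI) 2))
      l1 : t < length extended
      l1 = subst (t <_) (sym length-extended) (m<n⇒m<1+n t<N)
      l2 : suc t < length extended
      l2 = subst (suc t <_) (sym length-extended) (s≤s t<N)

    spoke : ∃[ s ] (s < length pI × E G (ext (suc (suc s))) (cyc (suc ℓ)))
    spoke with has-spoke
    ... | v , v∈ , adj with ∈-prefix⇒nth (cyc ℓ) py v∈
    ...   | s , s< , eq = s , s< ,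
              subst₂ (E G) (trans eq (sym (nth-++-prefix (cyc ℓ) pI py (cyc (suc (suc ℓ))) s (<⇒≤ s<)))) centre≡cyc adj

    inner-neighbours : ∀ s → s < len → ∀ u → E G (ext (suc s)) u → u ≡ ext s ⊎ u ≡ ext (suc (suc s)) ⊎ u ≡ cyc (suc ℓ)
    inner-neighbours s s< u adj with edges (ext (suc s)) u adj
    ... | inj₁ ((j , eq) , _) = ⊥-elim (inner-off-hole s s< j eq)
    ... | inj₂ (_ , _ , _ , inj₂ (j , eq) , _) = ⊥-elim (inner-off-hole s s< j eq)
    ... | inj₂ (i , P , listed′ , inj₁ on-P , u-side)
            with disjoint centre i (petal px pI py) P (ext (suc s)) listed listed′ (ext-inner-∈ s s<) on-P
    ...   | refl with trans (sym listed′) listed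
    ...     | refl with u-side
    ...       | inj₁ u∈L with ∈L⇒ext-inner u u∈L
    ...         | s' , s'< , refl with Equivalence.to (inner-adjacent s s' s< s'<) adj
    ...           | inj₁ refl = inj₂ (inj₁ refl)
    ...           | inj₂ refl = inj₁ refl
    inner-neighbours s s< u adj | inj₂ _ | refl | refl | inj₂ (j , refl)
            with L-hole-edges (ext (suc s)) j (ext-inner-∈ s s<) adj
    ... | inj₁ (next , is-x) = inj₁ (trans (left-unique j next) (cong ext (sym (inner-injective s 0 s< (s≤s z≤n) is-x))))
    ... | inj₂ (inj₁ (next , is-y)) = inj₂ (inj₁ (trans (right-unique j next) (trans (sym ext-N)
              (cong (λ z → ext (suc (suc z))) (sym (inner-injective s (suc (length pI)) s< ≤-refl (trans is-y (sym ext-len))))))))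
    ... | inj₂ (inj₂ (refl , _)) = inj₂ (inj₂ centre≡cyc)

  open PetalPath public

  classify : ∀ v → (∃[ j ] c j ≡ v) ⊎ (Σ PetalAt λ p → ∃[ s ] (s < len p × v ≡ ext p (suc s)))
  classify v with cover v
  ... | inj₁ on-hole = inj₁ on-hole
  ... | inj₂ (i , petal x I y , listed , v∈) with ∈L⇒ext-inner (petalAt i x I y listed) v v∈
  ...   | s , s< , eq = inj₂ (petalAt i x I y listed , s , s< , eq)

  hole-neighbours-of-inner : ∀ p s → s < len p → ∀ t → E G (cyc t) (ext p (suc s)) →
                             cyc t ≡ cyc (ℓ p) ⊎ cyc t ≡ cyc (suc (ℓ p)) ⊎ cyc t ≡ cyc (suc (suc (ℓ p)))
  hole-neighbours-of-inner p s s< t adj with inner-neighbours p s s< (cyc t) (E-sym adj)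
  hole-neighbours-of-inner p zero s< t adj | inj₁ eq = inj₁ eq
  hole-neighbours-of-inner p (suc s') s< t adj | inj₁ eq = ⊥-elim (inner-off-hole p s' (≤-trans (n≤1+n _) s<) (t mod k) eq)
  hole-neighbours-of-inner p s s< t adj | inj₂ (inj₂ eq) = inj₂ (inj₁ eq)
  hole-neighbours-of-inner p s s< t adj | inj₂ (inj₁ eq) with m≤n⇒m<n∨m≡n s<
  ... | inj₁ 1+s<len = ⊥-elim (inner-off-hole p (suc s) 1+s<len (t mod k) eq)
  ... | inj₂ refl = inj₂ (inj₂ (trans eq (ext-N p)))

module LocalStructure {n : ℕ} (G : Graph n) (D : IsDaisy G) where
  open Walks G
  open IndexedPaths G
  open IsDaisy D
  open Petals G D

  OffHole : Fin n → Set
  OffHole v = ∀ j → c j ≢ v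

  on-hole-or-off : ∀ v → (∃[ t ] v ≡ cyc t) ⊎ OffHole v
  on-hole-or-off v with classify v
  ... | inj₁ (j , eq) = inj₁ (toℕ j , trans (sym eq) (c≡cyc j))
  ... | inj₂ (p , s , s< , refl) = inj₂ (inner-off-hole p s s<)

  private
    s≤N : ∀ p {s} → s < len p → s ≤ N p
    s≤N p s< = ≤-trans (<⇒≤ s<) (n≤1+n _)

    2+s≤N : ∀ p {s} → s < len p → suc (suc s) ≤ N p
    2+s≤N p s< = s≤s s<

    skip : ∀ p s → s < len p → ¬ E G (ext p s) (ext p (suc (suc s)))
    skip p s s< adj with adjacent⇒consecutive (ext-indexedPath p) s (suc (suc s)) (s≤N p s<) (2+s≤N p s<) adj
    ... | inj₁ ()
    ... | inj₂ ()

  inner-in-no-triangle : ∀ p s → s < len p → ∀ u w → E G (ext p (suc s)) u → E G (ext p (suc s)) w → ¬ E G u w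
  inner-in-no-triangle p s s< u w vu vw uw with inner-neighbours p s s< u vu | inner-neighbours p s s< w vw
  ... | inj₁ refl        | inj₁ refl        = E-irrefl uw
  ... | inj₂ (inj₁ refl) | inj₂ (inj₁ refl) = E-irrefl uw
  ... | inj₂ (inj₂ refl) | inj₂ (inj₂ refl) = E-irrefl uw
  ... | inj₁ refl        | inj₂ (inj₁ refl) = skip p s s< uw
  ... | inj₂ (inj₁ refl) | inj₁ refl        = skip p s s< (E-sym uw)
  ... | inj₁ refl        | inj₂ (inj₂ refl) = no-edge-both-adjacent-centre p s (m≤n⇒m≤1+n s<) (uw , vw)
  ... | inj₂ (inj₂ refl) | inj₁ refl        = no-edge-both-adjacent-centre p s (m≤n⇒m≤1+n s<) (E-sym uw , vu)
  ... | inj₂ (inj₁ refl) | inj₂ (inj₂ refl) = no-edge-both-adjacent-centre p (suc s) (2+s≤N p s<) (vw , uw)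
  ... | inj₂ (inj₂ refl) | inj₂ (inj₁ refl) = no-edge-both-adjacent-centre p (suc s) (2+s≤N p s<) (vu , E-sym uw)

  triangle-free : ∀ u v w → E G u v → E G v w → ¬ E G u w
  triangle-free u v w uv vw uw with classify u | classify v | classify w
  ... | inj₂ (p , s , s< , refl) | _ | _ = inner-in-no-triangle p s s< v w uv uw vw
  ... | _ | inj₂ (p , s , s< , refl) | _ = inner-in-no-triangle p s s< u w (E-sym uv) vw uw
  ... | _ | _ | inj₂ (p , s , s< , refl) = inner-in-no-triangle p s s< u v (E-sym uw) (E-sym vw) uv
  ... | inj₁ (i , refl) | inj₁ (j , refl) | inj₁ (l , refl) =
        cyc-triangle-free (toℕ i) (toℕ j) (toℕ l) (subst₂ (E G) (c≡cyc i) (c≡cyc j) uv)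
                          (subst₂ (E G) (c≡cyc i) (c≡cyc l) uw) (subst₂ (E G) (c≡cyc j) (c≡cyc l) vw)

  two-neighbours : ∀ v → ∃[ u ] ∃[ w ] (E G v u × E G v w × u ≢ w)
  two-neighbours v with classify v
  ... | inj₁ (j , refl) = cyc (toℕ j + 1) , cyc (toℕ j + (k ∸ 1)) ,
         subst (λ z → E G z (cyc (toℕ j + 1))) (sym (c≡cyc j)) (cyc-+1-adjacent (toℕ j)) ,
         subst (λ z → E G z (cyc (toℕ j + (k ∸ 1)))) (sym (c≡cyc j)) (E-sym (cyc-−1-adjacent (toℕ j))) ,
         cyc-neighbours-≢ (toℕ j)
  ... | inj₂ (p , s , s< , refl) = ext p s , ext p (suc (suc s)) ,
         E-sym (consecutive-adjacent (ext-indexedPath p) s (m≤n⇒m≤1+n s<)) ,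
         consecutive-adjacent (ext-indexedPath p) (suc s) (2+s≤N p s<) ,
         λ eq → <-irrefl (injective (ext-indexedPath p) s (suc (suc s)) (s≤N p s<) (2+s≤N p s<) eq) (n≤1+n (suc s))

  private
    left-and-centre : ∀ p s → s < len p → E G (ext p (suc s)) (cyc (ℓ p)) → ¬ E G (ext p (suc s)) (cyc (suc (ℓ p)))
    left-and-centre p s s< vl vc with left-adjacent-inner⇒first p s s< (E-sym vl)
    ... | refl = no-edge-both-adjacent-centre p 0 (s≤s z≤n) (cyc-adjacent (ℓ p) , vc)

    right-and-centre : ∀ p s → s < len p → E G (ext p (suc s)) (cyc (suc (suc (ℓ p)))) → ¬ E G (ext p (suc s)) (cyc (suc (ℓ p)))
    right-and-centre p s s< vr vc = no-edge-both-adjacent-centre p (suc s) (2+s≤N p s<) (vc , next-adjacent)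
      where
      next-adjacent : E G (ext p (suc (suc s))) (cyc (suc (ℓ p)))
      next-adjacent = subst (λ z → E G (ext p z) (cyc (suc (ℓ p)))) (sym (cong suc (inner-adjacent-right⇒last p s s< vr)))
                        (subst (λ z → E G z (cyc (suc (ℓ p)))) (sym (ext-N p)) (E-sym (cyc-adjacent (suc (ℓ p)))))

    left-and-right : ∀ p s → s < len p → E G (ext p (suc s)) (cyc (ℓ p)) → ¬ E G (ext p (suc s)) (cyc (suc (suc (ℓ p))))
    left-and-right p s s< vl vr with left-adjacent-inner⇒first p s s< (E-sym vl) | inner-adjacent-right⇒last p s s< vr
    ... | refl | ()

  inner-one-hole-neighbour : ∀ p s → s < len p → ∀ tu tw → E G (ext p (suc s)) (cyc tu) → E G (ext p (suc s)) (cyc tw) →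
                             cyc tu ≡ cyc tw
  inner-one-hole-neighbour p s s< tu tw vu vw
    with hole-neighbours-of-inner p s s< tu (E-sym vu) | hole-neighbours-of-inner p s s< tw (E-sym vw)
  ... | inj₁ u≡          | inj₁ w≡          = trans u≡ (sym w≡)
  ... | inj₂ (inj₁ u≡)   | inj₂ (inj₁ w≡)   = trans u≡ (sym w≡)
  ... | inj₂ (inj₂ u≡)   | inj₂ (inj₂ w≡)   = trans u≡ (sym w≡)
  ... | inj₁ u≡          | inj₂ (inj₁ w≡)   = ⊥-elim (left-and-centre p s s< (subst (E G _) u≡ vu) (subst (E G _) w≡ vw))
  ... | inj₂ (inj₁ u≡)   | inj₁ w≡          = ⊥-elim (left-and-centre p s s< (subst (E G _) w≡ vw) (subst (E G _) u≡ vu))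
  ... | inj₂ (inj₂ u≡)   | inj₂ (inj₁ w≡)   = ⊥-elim (right-and-centre p s s< (subst (E G _) u≡ vu) (subst (E G _) w≡ vw))
  ... | inj₂ (inj₁ u≡)   | inj₂ (inj₂ w≡)   = ⊥-elim (right-and-centre p s s< (subst (E G _) w≡ vw) (subst (E G _) u≡ vu))
  ... | inj₁ u≡          | inj₂ (inj₂ w≡)   = ⊥-elim (left-and-right p s s< (subst (E G _) u≡ vu) (subst (E G _) w≡ vw))
  ... | inj₂ (inj₂ u≡)   | inj₁ w≡          = ⊥-elim (left-and-right p s s< (subst (E G _) w≡ vw) (subst (E G _) u≡ vu))

module Arcs {n : ℕ} (G : Graph n) (D : IsDaisy G) where
  open Walks G
  open IsDaisy D
  open Petals G D
  open LocalStructure G D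

  Located : ℕ → ℕ → Fin n → Set
  Located β m v = OffHole v ⊎ ∃[ d ] (d < m × v ≡ cyc (β + d))

  record HoleArc (P : Fin n → Set) : Set where
    constructor arc
    field
      β m     : ℕ
      m<k     : m < k
      arc⊆P   : ∀ d → d < m → P (cyc (β + d))
      located : ∀ v → P v → Located β m v

  HoleArc-transport : ∀ {P Q : Fin n → Set} → (∀ v → Q v ⇔ P v) → HoleArc P → HoleArc Q
  HoleArc-transport Q⇔P (arc β m m<k arc⊆P located) =
    arc β m m<k (λ d d<m → Equivalence.from (Q⇔P _) (arc⊆P d d<m)) (λ v q → located v (Equivalence.to (Q⇔P v) q))

  Pair : Fin n → Fin n → Fin n → Set
  Pair u w v = v ≡ u ⊎ v ≡ w

  Triple : Fin n → Fin n → Fin n → Fin n → Set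
  Triple a c b v = v ≡ a ⊎ v ≡ c ⊎ v ≡ b

  private
    at : ∀ {β m v} d → d < m → v ≡ cyc (β + d) → Located β m v
    at d d<m eq = inj₂ (d , d<m , eq)

    0<1 : 0 < 1
    0<1 = s≤s z≤n
    0<2 : 0 < 2
    0<2 = s≤s z≤n
    1<2 : 1 < 2
    1<2 = s≤s (s≤s z≤n)
    0<3 : 0 < 3
    0<3 = s≤s z≤n
    1<3 : 1 < 3
    1<3 = s≤s (s≤s z≤n)
    2<3 : 2 < 3
    2<3 = s≤s (s≤s (s≤s z≤n))

    arc₀ : ∀ {Q : ℕ → Set} d → d < 0 → Q d
    arc₀ _ ()

    arc₁ : ∀ {Q : ℕ → Set} → Q 0 → ∀ d → d < 1 → Q d
    arc₁ q0 zero _ = q0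
    arc₁ q0 (suc _) (s≤s ())

    arc₂ : ∀ {Q : ℕ → Set} → Q 0 → Q 1 → ∀ d → d < 2 → Q d
    arc₂ q0 q1 zero _ = q0
    arc₂ q0 q1 (suc zero) _ = q1
    arc₂ q0 q1 (suc (suc _)) (s≤s (s≤s ()))

    arc₃ : ∀ {Q : ℕ → Set} → Q 0 → Q 1 → Q 2 → ∀ d → d < 3 → Q d
    arc₃ q0 q1 q2 zero _ = q0
    arc₃ q0 q1 q2 (suc zero) _ = q1
    arc₃ q0 q1 q2 (suc (suc zero)) _ = q2
    arc₃ q0 q1 q2 (suc (suc (suc _))) (s≤s (s≤s (s≤s ())))

    3<k : 3 < k
    3<k = 4≤k

  adjacent-on-hole : ∀ tu tw → E G (cyc tu) (cyc tw) →
                     ∃[ β ] ((cyc tu ≡ cyc (β + 0) × cyc tw ≡ cyc (β + 1)) ⊎ (cyc tw ≡ cyc (β + 0) × cyc tu ≡ cyc (β + 1)))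
  adjacent-on-hole tu tw uw with cyc-neighbours tu tw uw
  ... | inj₁ w≡ = tu , inj₁ (sym (cyc-+0 tu) , w≡)
  ... | inj₂ w≡ = tu + (k ∸ 1) , inj₂ (trans w≡ (sym (cyc-+0 _)) , sym (cyc-back₁ tu))

  pair-arc : ∀ {u w} → E G u w ⊎ (OffHole u ⊎ OffHole w) → HoleArc (Pair u w)
  pair-arc {u} {w} h with on-hole-or-off u | on-hole-or-off w
  ... | inj₂ u-off | inj₂ w-off =
    arc 0 0 0<k arc₀ λ { _ (inj₁ refl) → inj₁ u-off ; _ (inj₂ refl) → inj₁ w-off }
  ... | inj₁ (tu , refl) | inj₂ w-off =
    arc tu 1 1<k (arc₁ (inj₁ (cyc-+0 tu))) λ { _ (inj₁ refl) → at 0 0<1 (sym (cyc-+0 tu)) ; _ (inj₂ refl) → inj₁ w-off }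
  ... | inj₂ u-off | inj₁ (tw , refl) =
    arc tw 1 1<k (arc₁ (inj₂ (cyc-+0 tw))) λ { _ (inj₁ refl) → inj₁ u-off ; _ (inj₂ refl) → at 0 0<1 (sym (cyc-+0 tw)) }
  ... | inj₁ (tu , refl) | inj₁ (tw , refl) with h
  ...   | inj₂ (inj₁ u-off) = ⊥-elim (u-off (tu mod k) refl)
  ...   | inj₂ (inj₂ w-off) = ⊥-elim (w-off (tw mod k) refl)
  ...   | inj₁ uw with adjacent-on-hole tu tw uw
  ...     | β , inj₁ (u≡ , w≡) =
    arc β 2 2<k (arc₂ (inj₁ (sym u≡)) (inj₂ (sym w≡))) λ { _ (inj₁ refl) → at 0 0<2 u≡ ; _ (inj₂ refl) → at 1 1<2 w≡ }
  ...     | β , inj₂ (w≡ , u≡) =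
    arc β 2 2<k (arc₂ (inj₂ (sym w≡)) (inj₁ (sym u≡))) λ { _ (inj₁ refl) → at 1 1<2 u≡ ; _ (inj₂ refl) → at 0 0<2 w≡ }

  off-hole-middle : ∀ {a c b} → E G a c → E G c b → a ≢ b → OffHole c → OffHole a ⊎ OffHole b
  off-hole-middle {a} {c} {b} ac cb a≢b c-off with classify c | on-hole-or-off a | on-hole-or-off b
  ... | inj₁ (j , eq) | _ | _ = ⊥-elim (c-off j eq)
  ... | _ | inj₂ a-off | _ = inj₁ a-off
  ... | _ | _ | inj₂ b-off = inj₂ b-off
  ... | inj₂ (p , s , s< , refl) | inj₁ (ta , refl) | inj₁ (tb , refl) =
        ⊥-elim (a≢b (inner-one-hole-neighbour p s s< ta tb (E-sym ac) cb))

  with-off-hole : ∀ {P : Fin n → Set} {c} → OffHole c → HoleArc P → HoleArc (λ v → v ≡ c ⊎ P v)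
  with-off-hole c-off (arc β m m<k arc⊆P located) =
    arc β m m<k (λ d d<m → inj₂ (arc⊆P d d<m)) λ { _ (inj₁ refl) → inj₁ c-off ; v (inj₂ pv) → located v pv }

  private
    reorder : ∀ {A B C : Set} → A ⊎ B ⊎ C → B ⊎ A ⊎ C
    reorder (inj₁ a) = inj₂ (inj₁ a)
    reorder (inj₂ (inj₁ b)) = inj₁ b
    reorder (inj₂ (inj₂ c)) = inj₂ (inj₂ c)

  triple-arc : ∀ {a c b} → E G a c → E G c b → a ≢ b → HoleArc (Triple a c b)
  triple-arc {a} {c} {b} ac cb a≢b with on-hole-or-off c
  ... | inj₂ c-off = HoleArc-transport (λ _ → mk⇔ reorder reorder)
                                 (with-off-hole c-off (pair-arc (inj₂ (off-hole-middle ac cb a≢b c-off))))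
  ... | inj₁ (tc , refl) with on-hole-or-off a | on-hole-or-off b
  ...   | inj₂ a-off | inj₂ b-off =
    arc tc 1 1<k (arc₁ (inj₂ (inj₁ (cyc-+0 tc))))
      λ { _ (inj₁ refl) → inj₁ a-off ; _ (inj₂ (inj₁ refl)) → at 0 0<1 (sym (cyc-+0 tc)) ; _ (inj₂ (inj₂ refl)) → inj₁ b-off }
  ...   | inj₁ (ta , refl) | inj₂ b-off with adjacent-on-hole tc ta (E-sym ac)
  ...     | β , inj₁ (c≡ , a≡) =
    arc β 2 2<k (arc₂ (inj₂ (inj₁ (sym c≡))) (inj₁ (sym a≡)))
      λ { _ (inj₁ refl) → at 1 1<2 a≡ ; _ (inj₂ (inj₁ refl)) → at 0 0<2 c≡ ; _ (inj₂ (inj₂ refl)) → inj₁ b-off }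
  ...     | β , inj₂ (a≡ , c≡) =
    arc β 2 2<k (arc₂ (inj₁ (sym a≡)) (inj₂ (inj₁ (sym c≡))))
      λ { _ (inj₁ refl) → at 0 0<2 a≡ ; _ (inj₂ (inj₁ refl)) → at 1 1<2 c≡ ; _ (inj₂ (inj₂ refl)) → inj₁ b-off }
  triple-arc {a} {c} {b} ac cb a≢b | inj₁ (tc , refl) | inj₂ a-off | inj₁ (tb , refl) with adjacent-on-hole tc tb cb
  ...     | β , inj₁ (c≡ , b≡) =
    arc β 2 2<k (arc₂ (inj₂ (inj₁ (sym c≡))) (inj₂ (inj₂ (sym b≡))))
      λ { _ (inj₁ refl) → inj₁ a-off ; _ (inj₂ (inj₁ refl)) → at 0 0<2 c≡ ; _ (inj₂ (inj₂ refl)) → at 1 1<2 b≡ }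
  ...     | β , inj₂ (b≡ , c≡) =
    arc β 2 2<k (arc₂ (inj₂ (inj₂ (sym b≡))) (inj₂ (inj₁ (sym c≡))))
      λ { _ (inj₁ refl) → inj₁ a-off ; _ (inj₂ (inj₁ refl)) → at 1 1<2 c≡ ; _ (inj₂ (inj₂ refl)) → at 0 0<2 b≡ }
  triple-arc {a} {c} {b} ac cb a≢b | inj₁ (tc , refl) | inj₁ (ta , refl) | inj₁ (tb , refl)
    with cyc-neighbours tc ta (E-sym ac) | cyc-neighbours tc tb cb
  ... | inj₁ a≡ | inj₁ b≡ = ⊥-elim (a≢b (trans a≡ (sym b≡)))
  ... | inj₂ a≡ | inj₂ b≡ = ⊥-elim (a≢b (trans a≡ (sym b≡)))
  ... | inj₁ a≡ | inj₂ b≡ =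
    arc (tc + (k ∸ 1)) 3 3<k
      (arc₃ (inj₂ (inj₂ (trans (cyc-+0 _) (sym b≡)))) (inj₂ (inj₁ (cyc-back₁ tc))) (inj₁ (trans (cyc-back tc 1) (sym a≡))))
      λ { _ (inj₁ refl) → at 2 2<3 (trans a≡ (sym (cyc-back tc 1))) ; _ (inj₂ (inj₁ refl)) → at 1 1<3 (sym (cyc-back₁ tc))
        ; _ (inj₂ (inj₂ refl)) → at 0 0<3 (trans b≡ (sym (cyc-+0 _))) }
  ... | inj₂ a≡ | inj₁ b≡ =
    arc (tc + (k ∸ 1)) 3 3<k
      (arc₃ (inj₁ (trans (cyc-+0 _) (sym a≡))) (inj₂ (inj₁ (cyc-back₁ tc))) (inj₂ (inj₂ (trans (cyc-back tc 1) (sym b≡)))))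
      λ { _ (inj₁ refl) → at 0 0<3 (trans a≡ (sym (cyc-+0 _))) ; _ (inj₂ (inj₁ refl)) → at 1 1<3 (sym (cyc-back₁ tc))
        ; _ (inj₂ (inj₂ refl)) → at 2 2<3 (trans b≡ (sym (cyc-back tc 1))) }

module Search (B : ℕ → Set) (B? : ∀ x → Dec (B x)) where

  last-at-or-below : ∀ t → (∀ t' → t' ≤ t → ¬ B t') ⊎ ∃[ t1 ] (t1 ≤ t × B t1 × (∀ t' → t1 < t' → t' ≤ t → ¬ B t'))
  last-at-or-below zero with B? 0
  ... | yes b = inj₂ (0 , z≤n , b , λ t' l1 l2 → ⊥-elim (<-irrefl refl (<-≤-trans l1 l2)))
  ... | no ¬b = inj₁ (λ { zero _ → ¬b })
  last-at-or-below (suc t) with B? (suc t)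
  ... | yes b = inj₂ (suc t , ≤-refl , b , λ t' l1 l2 → ⊥-elim (<-irrefl refl (<-≤-trans l1 l2)))
  ... | no ¬b with last-at-or-below t
  ...   | inj₁ none = inj₁ none′
    where
    none′ : ∀ t' → t' ≤ suc t → ¬ B t'
    none′ t' t'≤ with m≤n⇒m<n∨m≡n t'≤
    ... | inj₁ t'< = none t' (≤-pred t'<)
    ... | inj₂ refl = ¬b
  ...   | inj₂ (t1 , t1≤ , b , after) = inj₂ (t1 , m≤n⇒m≤1+n t1≤ , b , after′)
    where
    after′ : ∀ t' → t1 < t' → t' ≤ suc t → ¬ B t'
    after′ t' t1<t' t'≤ with m≤n⇒m<n∨m≡n t'≤
    ... | inj₁ t'< = after t' t1<t' (≤-pred t'<)
    ... | inj₂ refl = ¬b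

  first-from : ∀ t d → (∀ t' → t ≤ t' → t' ≤ t + d → ¬ B t') ⊎
                       ∃[ t2 ] (t ≤ t2 × t2 ≤ t + d × B t2 × (∀ t' → t ≤ t' → t' < t2 → ¬ B t'))
  first-from t d with B? t
  ... | yes b = inj₂ (t , ≤-refl , m≤m+n t d , b , λ t' l1 l2 → ⊥-elim (<-irrefl refl (≤-<-trans l1 l2)))
  first-from t zero | no ¬b = inj₁ (λ t' l1 l2 → subst (λ z → ¬ B z) (≤-antisym l1 (subst (t' ≤_) (+-identityʳ t) l2)) ¬b)
  first-from t (suc d) | no ¬b with first-from (suc t) d
  ... | inj₁ none = inj₁ none′
    where
    none′ : ∀ t' → t ≤ t' → t' ≤ t + suc d → ¬ B t'
    none′ t' t≤t' t'≤ with m≤n⇒m<n∨m≡n t≤t'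
    ... | inj₁ t<t' = none t' t<t' (subst (t' ≤_) (+-suc t d) t'≤)
    ... | inj₂ refl = ¬b
  ... | inj₂ (t2 , t<t2 , t2≤ , b , before) = inj₂ (t2 , ≤-trans (n≤1+n t) t<t2 , subst (t2 ≤_) (sym (+-suc t d)) t2≤ , b , before′)
    where
    before′ : ∀ t' → t ≤ t' → t' < t2 → ¬ B t'
    before′ t' t≤t' t'<t2 with m≤n⇒m<n∨m≡n t≤t'
    ... | inj₁ t<t' = before t' t<t' t'<t2
    ... | inj₂ refl = ¬b

  first-in : ∀ t hi → t ≤ hi → (∀ t' → t ≤ t' → t' ≤ hi → ¬ B t') ⊎
                               ∃[ t2 ] (t ≤ t2 × t2 ≤ hi × B t2 × (∀ t' → t ≤ t' → t' < t2 → ¬ B t'))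
  first-in t hi t≤hi = subst (λ h → (∀ t' → t ≤ t' → t' ≤ h → ¬ B t') ⊎
                                    ∃[ t2 ] (t ≤ t2 × t2 ≤ h × B t2 × (∀ t' → t ≤ t' → t' < t2 → ¬ B t')))
                             (m+[n∸m]≡n t≤hi) (first-from t (hi ∸ t))

  some-below : ∀ m → (∃[ x ] (x < m × B x)) ⊎ (∀ x → x < m → ¬ B x)
  some-below zero = inj₂ (λ x ())
  some-below (suc m) with B? m
  ... | yes b = inj₁ (m , ≤-refl , b)
  ... | no ¬b with some-below m
  ...   | inj₁ (x , x<m , b) = inj₁ (x , m<n⇒m<1+n x<m , b)
  ...   | inj₂ none = inj₂ none′
    where
    none′ : ∀ x → x < suc m → ¬ B x
    none′ x x<1+m with m≤n⇒m<n∨m≡n (≤-pred x<1+m)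
    ... | inj₁ x<m = none x x<m
    ... | inj₂ refl = ¬b

module Separation {n : ℕ} (G : Graph n) (D : IsDaisy G) (S : Subset n) where
  open Walks G
  open IndexedPaths G
  open IsDaisy D
  open Petals G D
  open LocalStructure G D
  open Arcs G D

  record Stretch (p : PetalAt) (t : ℕ) : Set where
    field
      lo hi  : ℕ
      lo<t   : lo < t
      t<hi   : t < hi
      hi≤N   : hi ≤ N p
      lo∈S   : ext p lo ∈ S
      hi∈S   : ext p hi ∈ S
      avoids : ∀ t' → lo < t' → t' < hi → ext p t' ∉ S

    lo<hi : lo < hi
    lo<hi = <-trans lo<t t<hi

    lo≤N : lo ≤ N p
    lo≤N = ≤-trans (<⇒≤ lo<hi) hi≤N

    stretch-walk : ∀ x → lo < x → x < hi → Walk (Outside S) (ext p t) (ext p x)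
    stretch-walk x lo<x x<hi = walk-within (ext p) lo hi avoids
      (λ s _ 1+s<hi → consecutive-adjacent (ext-indexedPath p) s (<-≤-trans (<-trans (n<1+n s) 1+s<hi) hi≤N))
      t x lo<t t<hi lo<x x<hi
  open Stretch public

  stretch-ends-distinct : ∀ {p t} (st : Stretch p t) → ext p (lo st) ≢ ext p (hi st)
  stretch-ends-distinct {p} st eq =
    <-irrefl (injective (ext-indexedPath p) _ _ (lo≤N st) (hi≤N st) eq) (lo<hi st)

  stretch-ends-nonadjacent : ∀ {p t} (st : Stretch p t) → ¬ E G (ext p (lo st)) (ext p (hi st))
  stretch-ends-nonadjacent {p} st adj with adjacent⇒consecutive (ext-indexedPath p) _ _ (lo≤N st) (hi≤N st) adj
  ... | inj₁ eq = <-irrefl refl (<-≤-trans (lo<t st) (≤-pred (subst (_ <_) (sym eq) (t<hi st))))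
  ... | inj₂ eq = <-asym (lo<hi st) (subst (hi st <_) eq (n<1+n (hi st)))

  CentreBlocked : ∀ {p t} → Stretch p t → Set
  CentreBlocked {p} st = ∀ t' → lo st < t' → t' < hi st → E G (ext p t') (cyc (suc (ℓ p))) → cyc (suc (ℓ p)) ∈ S

  IsolatedRun : PetalAt → ℕ → Set
  IsolatedRun p t = Σ (Stretch p t) CentreBlocked

  ReachesHole : Fin n → Set
  ReachesHole v = ∃[ t0 ] (cyc t0 ∉ S × Walk (Outside S) v (cyc t0))

  reaches-hole-or-stretch : ∀ p s → s < len p → ext p (suc s) ∉ S → ReachesHole (ext p (suc s)) ⊎ Stretch p (suc s)
  reaches-hole-or-stretch p s s< vS with Search.last-at-or-below (λ x → ext p x ∈ S) (λ x → ext p x ∈? S) (suc s)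
  ... | inj₁ none-below = inj₁ (ℓ p , none-below 0 z≤n ,
          walk-along (ext p) 0 (suc s) (λ t _ t≤ → none-below t t≤)
            (λ t _ t< → consecutive-adjacent (ext-indexedPath p) t (<-≤-trans t< (m≤n⇒m≤1+n s<))) (suc s) 0 z≤n ≤-refl z≤n z≤n)
  ... | inj₂ (t1 , t1≤ , t1∈S , after) with Search.first-in (λ x → ext p x ∈ S) (λ x → ext p x ∈? S) (suc s) (N p) (m≤n⇒m≤1+n s<)
  ...   | inj₁ none-above = inj₁ (suc (suc (ℓ p)) , subst (_∉ S) (ext-N p) (none-above (N p) (m≤n⇒m≤1+n s<) ≤-refl) ,
           subst (Walk (Outside S) (ext p (suc s))) (ext-N p)
             (walk-along (ext p) (suc s) (N p) none-above (λ t _ t< → consecutive-adjacent (ext-indexedPath p) t t<)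
                         (suc s) (N p) ≤-refl (m≤n⇒m≤1+n s<) (m≤n⇒m≤1+n s<) ≤-refl))
  ...   | inj₂ (t2 , t≤t2 , t2≤ , t2∈S , before) = inj₂ (record
          { lo = t1 ; hi = t2
          ; lo<t = ≤∧≢⇒< t1≤ (λ eq → vS (subst (λ z → ext p z ∈ S) eq t1∈S))
          ; t<hi = ≤∧≢⇒< t≤t2 (λ eq → vS (subst (λ z → ext p z ∈ S) (sym eq) t2∈S))
          ; hi≤N = t2≤
          ; lo∈S = t1∈S ; hi∈S = t2∈S
          ; avoids = avoids′
          })
    where
    avoids′ : ∀ t' → t1 < t' → t' < t2 → ext p t' ∉ S
    avoids′ t' t1<t' t'<t2 with t' ≤? suc s
    ... | yes t'≤ = after t' t1<t' t'≤
    ... | no t'≰ = before t' (<⇒≤ (≰⇒> t'≰)) t'<t2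

  stretch-reaches-hole-or-blocked : ∀ p t (st : Stretch p t) → ReachesHole (ext p t) ⊎ CentreBlocked st
  stretch-reaches-hole-or-blocked p t st with cyc (suc (ℓ p)) ∈? S
  ... | yes centre∈S = inj₂ (λ _ _ _ _ → centre∈S)
  ... | no centre∉S with Search.some-below (λ x → lo st < x × E G (ext p x) (cyc (suc (ℓ p))))
                           (λ x → (lo st <? x) ×-dec E? (ext p x) (cyc (suc (ℓ p)))) (hi st)
  ...   | inj₁ (x , x<hi , lo<x , spoke) = inj₁ (suc (ℓ p) , centre∉S , snocʷ (stretch-walk st x lo<x x<hi) spoke centre∉S)
  ...   | inj₂ no-spoke = inj₂ (λ t' lo<t' t'<hi spoke → ⊥-elim (no-spoke t' t'<hi (lo<t' , spoke)))

  reaches-hole-or-isolated : ∀ p s → s < len p → ext p (suc s) ∉ S → ReachesHole (ext p (suc s)) ⊎ IsolatedRun p (suc s)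
  reaches-hole-or-isolated p s s< vS with reaches-hole-or-stretch p s s< vS
  ... | inj₁ reaches = inj₁ reaches
  ... | inj₂ st with stretch-reaches-hole-or-blocked p (suc s) st
  ...   | inj₁ reaches = inj₁ reaches
  ...   | inj₂ blocked = inj₂ (st , blocked)

  isolated-run-closed : ∀ {p t} ((st , blocked) : IsolatedRun p t) →
                        ∀ s' w → lo st < s' → s' < hi st → E G (ext p s') w → w ∉ S →
                        ∃[ s'' ] (lo st < s'' × s'' < hi st × w ≡ ext p s'')
  isolated-run-closed {p} (st , blocked) (suc s) w lo<1+s 1+s<hi adj wS
    with inner-neighbours p s (≤-pred (<-≤-trans 1+s<hi (hi≤N st))) w adj
  ... | inj₁ eq with lo st <? s
  ...   | yes lo<s = s , lo<s , <-trans (n<1+n s) 1+s<hi , eq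
  ...   | no lo≮s = ⊥-elim (wS (subst (_∈ S) (trans (cong (ext p) (≤-antisym (≤-pred lo<1+s) (≮⇒≥ lo≮s))) (sym eq)) (lo∈S st)))
  isolated-run-closed {p} (st , blocked) (suc s) w lo<1+s 1+s<hi adj wS | inj₂ (inj₁ eq) with suc (suc s) <? hi st
  ...   | yes 2+s<hi = suc (suc s) , <-trans lo<1+s (n<1+n _) , 2+s<hi , eq
  ...   | no 2+s≮hi = ⊥-elim (wS (subst (_∈ S) (trans (cong (ext p) (≤-antisym (≮⇒≥ 2+s≮hi) 1+s<hi)) (sym eq)) (hi∈S st)))
  isolated-run-closed {p} (st , blocked) (suc s) w lo<1+s 1+s<hi adj wS | inj₂ (inj₂ eq) =
    ⊥-elim (wS (subst (_∈ S) (sym eq) (blocked (suc s) lo<1+s 1+s<hi (subst (E G (ext p (suc s))) eq adj))))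

  StretchEnds : Fin n → Fin n → Set
  StretchEnds a b = ∀ p t (st : Stretch p t) →
                    (ext p (lo st) ≡ a × ext p (hi st) ≡ b) ⊎ (ext p (lo st) ≡ b × ext p (hi st) ≡ a)

  isolated-run-ABPiece : ∀ {a b p t} → StretchEnds a b → IsolatedRun p t → ABPiece S a b (ext p t)
  isolated-run-ABPiece {p = p} {t} ends run@(st , _) =
    [ uncurry segment , (λ (lo≡b , hi≡a) → ABPiece-swap (segment lo≡b hi≡a)) ]′ (ends p t st)
    where
    segment : ∀ {a b} → ext p (lo st) ≡ a → ext p (hi st) ≡ b → ABPiece S a b (ext p t)
    segment lo≡ hi≡ = segment⇒ABPiece (ext p) (N p) (ext-indexedPath p) (lo st) t (hi st) (lo<t st) (t<hi st) (hi≤N st)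
                        lo≡ hi≡ (avoids st) (isolated-run-closed run)

  two-vertex-StretchEnds : ∀ {a b} → (∀ v → v ∈ S ⇔ (v ≡ a ⊎ v ≡ b)) → StretchEnds a b
  two-vertex-StretchEnds S≡ p t st with Equivalence.to (S≡ _) (lo∈S st) | Equivalence.to (S≡ _) (hi∈S st)
  ... | inj₁ lo≡a | inj₂ hi≡b = inj₁ (lo≡a , hi≡b)
  ... | inj₂ lo≡b | inj₁ hi≡a = inj₂ (lo≡b , hi≡a)
  ... | inj₁ lo≡a | inj₁ hi≡a = ⊥-elim (stretch-ends-distinct st (trans lo≡a (sym hi≡a)))
  ... | inj₂ lo≡b | inj₂ hi≡b = ⊥-elim (stretch-ends-distinct st (trans lo≡b (sym hi≡b)))

  -- the ends of a stretch are distinct and nonadjacent, so they are a and b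
  three-vertex-StretchEnds : ∀ {a b c} → (∀ v → v ∈ S ⇔ (v ≡ a ⊎ v ≡ c ⊎ v ≡ b)) → E G a c → E G c b → StretchEnds a b
  three-vertex-StretchEnds {a} {b} {c} S≡ ac cb p t st
    with Equivalence.to (S≡ _) (lo∈S st) | Equivalence.to (S≡ _) (hi∈S st)
  ... | inj₁ refl        | inj₂ (inj₂ refl) = inj₁ (refl , refl)
  ... | inj₂ (inj₂ refl) | inj₁ refl        = inj₂ (refl , refl)
  ... | inj₁ refl        | inj₁ eq          = ⊥-elim (stretch-ends-distinct st (sym eq))
  ... | inj₂ (inj₁ refl) | inj₂ (inj₁ eq)   = ⊥-elim (stretch-ends-distinct st (sym eq))
  ... | inj₂ (inj₂ refl) | inj₂ (inj₂ eq)   = ⊥-elim (stretch-ends-distinct st (sym eq))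
  ... | inj₂ (inj₁ refl) | inj₁ refl        = ⊥-elim (stretch-ends-nonadjacent st (E-sym ac))
  ... | inj₂ (inj₁ refl) | inj₂ (inj₂ refl) = ⊥-elim (stretch-ends-nonadjacent st cb)
  ... | inj₁ refl        | inj₂ (inj₁ refl) = ⊥-elim (stretch-ends-nonadjacent st ac)
  ... | inj₂ (inj₂ refl) | inj₂ (inj₁ refl) = ⊥-elim (stretch-ends-nonadjacent st (E-sym cb))

  arc-walk : ∀ β lo hi → hi < k → (∀ x → lo ≤ x → x ≤ hi → cyc (β + x) ∉ S) →
             ∀ x y → lo ≤ x → x ≤ hi → lo ≤ y → y ≤ hi → Walk (Outside S) (cyc (β + x)) (cyc (β + y))
  arc-walk β lo hi _ avoid = walk-along (λ z → cyc (β + z)) lo hi avoid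
    (λ z _ _ → subst (λ q → E G (cyc (β + z)) (cyc q)) (sym (+-suc β z)) (cyc-adjacent (β + z)))

  module ArcCut (A : HoleArc (_∈ S)) where
    open HoleArc A

    outside-arc : ∀ d → m ≤ d → d < k → cyc (β + d) ∉ S
    outside-arc d m≤d d<k inS with located _ inS
    ... | inj₁ off = off ((β + d) mod k) refl
    ... | inj₂ (d' , d'<m , eq) = <-irrefl refl
          (<-≤-trans (subst (_< m) (sym (cyc-offset-injective β d d' d<k (<-trans d'<m (≤-<-trans m≤d d<k)) eq)) d'<m) m≤d)

    r : Fin n
    r = cyc (β + m)

    r∉S : r ∉ S
    r∉S = outside-arc m ≤-refl m<k

    hole-reaches-r : ∀ t → cyc t ∉ S → Walk (Outside S) (cyc t) r
    hole-reaches-r t tS with cyc-offset β t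
    ... | d , d<k , eq with d <? m
    ...   | yes d<m = ⊥-elim (tS (subst (_∈ S) (sym eq) (arc⊆P d d<m)))
    ...   | no d≮m = subst (λ z → Walk (Outside S) z r) (sym eq)
              (arc-walk β m d d<k (λ x a b → outside-arc x a (≤-<-trans b d<k)) d m (≮⇒≥ d≮m) ≤-refl ≤-refl (≮⇒≥ d≮m))

    reaches-r-or-isolated : ∀ v → v ∉ S → Walk (Outside S) v r ⊎ (Σ PetalAt λ p → ∃[ t ] (v ≡ ext p t × IsolatedRun p t))
    reaches-r-or-isolated v vS with classify v
    ... | inj₁ (j , refl) = inj₁ (subst (λ z → Walk (Outside S) z r) (sym (c≡cyc j)) (hole-reaches-r (toℕ j) (subst (_∉ S) (c≡cyc j) vS)))
    ... | inj₂ (p , s , s< , refl) with reaches-hole-or-isolated p s s< vS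
    ...   | inj₁ (t0 , t0S , walk) = inj₁ (walk ++ʷ hole-reaches-r t0 t0S)
    ...   | inj₂ run = inj₂ (p , suc s , refl , run)

  arc-cut-ABPath-component : ∀ {a b X Y} → HoleArc (_∈ S) → StretchEnds a b → ExactlyTwoComponents G S X Y →
                             InducesABPath G a b X ⊎ InducesABPath G a b Y
  arc-cut-ABPath-component {a} {b} A ends two = one-component-induces-ABPath two r r∉S to-r-or-piece
    where
    open ArcCut A
    to-r-or-piece : ∀ v → v ∉ S → Walk (Outside S) v r ⊎ ABPiece S a b v
    to-r-or-piece v vS with reaches-r-or-isolated v vS
    ... | inj₁ walk = inj₁ walk
    ... | inj₂ (p , t , refl , run) = inj₂ (isolated-run-ABPiece ends run)

  arc-cut-connected : HoleArc (_∈ S) → (∀ p t → ¬ Stretch p t) → ∃[ r ] (r ∉ S × (∀ v → v ∉ S → Walk (Outside S) v r))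
  arc-cut-connected A no-stretch = r , r∉S , to-r
    where
    open ArcCut A
    to-r : ∀ v → v ∉ S → Walk (Outside S) v r
    to-r v vS with reaches-r-or-isolated v vS
    ... | inj₁ walk = walk
    ... | inj₂ (p , t , _ , st , _) = ⊥-elim (no-stretch p t st)

∈-pair : ∀ {n} {u w v : Fin n} → v ∈ ⁅ u ⁆ ∪ ⁅ w ⁆ ⇔ (v ≡ u ⊎ v ≡ w)
∈-pair {u = u} {w} {v} = mk⇔ to from
  where
  to : v ∈ ⁅ u ⁆ ∪ ⁅ w ⁆ → v ≡ u ⊎ v ≡ w
  to v∈ with x∈p∪q⁻ ⁅ u ⁆ ⁅ w ⁆ v∈
  ... | inj₁ v∈u = inj₁ (x∈⁅y⁆⇒x≡y u v∈u)
  ... | inj₂ v∈w = inj₂ (x∈⁅y⁆⇒x≡y w v∈w)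
  from : v ≡ u ⊎ v ≡ w → v ∈ ⁅ u ⁆ ∪ ⁅ w ⁆
  from (inj₁ refl) = x∈p∪q⁺ (inj₁ (x∈⁅x⁆ v))
  from (inj₂ refl) = x∈p∪q⁺ {p = ⁅ u ⁆} (inj₂ (x∈⁅x⁆ v))

no-three-distinct-in-pair : ∀ {A : Set} {u w x y z : A} → (x ≡ u ⊎ x ≡ w) → (y ≡ u ⊎ y ≡ w) → (z ≡ u ⊎ z ≡ w) →
                            x ≢ y → x ≢ z → y ≢ z → ⊥
no-three-distinct-in-pair (inj₁ refl) (inj₁ refl) _ x≢y _ _ = x≢y refl
no-three-distinct-in-pair (inj₂ refl) (inj₂ refl) _ x≢y _ _ = x≢y refl
no-three-distinct-in-pair (inj₁ refl) (inj₂ refl) (inj₁ refl) _ x≢z _ = x≢z refl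
no-three-distinct-in-pair (inj₁ refl) (inj₂ refl) (inj₂ refl) _ _ y≢z = y≢z refl
no-three-distinct-in-pair (inj₂ refl) (inj₁ refl) (inj₁ refl) _ _ y≢z = y≢z refl
no-three-distinct-in-pair (inj₂ refl) (inj₁ refl) (inj₂ refl) _ x≢z _ = x≢z refl

module CliqueSeparators {n : ℕ} (G : Graph n) (D : IsDaisy G) where
  open Walks G
  open IsDaisy D
  open Petals G D
  open LocalStructure G D
  open Arcs G D

  edge-removal-connected : ∀ {u w} → E G u w →
    ∃[ r ] (r ∉ ⁅ u ⁆ ∪ ⁅ w ⁆ × (∀ v → v ∉ ⁅ u ⁆ ∪ ⁅ w ⁆ → Walk (Outside (⁅ u ⁆ ∪ ⁅ w ⁆)) v r))
  edge-removal-connected {u} {w} uw =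
    arc-cut-connected (HoleArc-transport (λ _ → ∈-pair) (pair-arc (inj₁ uw))) no-stretch
    where
    open Separation G D (⁅ u ⁆ ∪ ⁅ w ⁆)
    no-stretch : ∀ p t → ¬ Stretch p t
    no-stretch p t st with two-vertex-StretchEnds (λ _ → ∈-pair) p t st
    ... | inj₁ (lo≡u , hi≡w) = stretch-ends-nonadjacent st (subst₂ (E G) (sym lo≡u) (sym hi≡w) uw)
    ... | inj₂ (lo≡w , hi≡u) = stretch-ends-nonadjacent st (subst₂ (E G) (sym lo≡w) (sym hi≡u) (E-sym uw))

  clique-within-edge : ∀ K → (∀ u v → u ∈ K → v ∈ K → u ≢ v → E G u v) →
                       ∃[ u ] ∃[ w ] (E G u w × (∀ z → z ∈ K → z ≡ u ⊎ z ≡ w))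
  clique-within-edge K clique with any? (_∈? K)
  ... | no empty = cyc 0 , cyc 1 , cyc-adjacent 0 , λ z z∈K → ⊥-elim (empty (z , z∈K))
  ... | yes (u , u∈K) with any? (λ v → (v ∈? K) ×-dec ¬? (v ≟ᶠ u))
  ...   | no only-u with two-neighbours u
  ...     | w , _ , uw , _ = u , w , uw , λ z z∈K → inj₁ (is-u z z∈K)
    where
    is-u : ∀ z → z ∈ K → z ≡ u
    is-u z z∈K with z ≟ᶠ u
    ... | yes z≡u = z≡u
    ... | no z≢u = ⊥-elim (only-u (z , z∈K , z≢u))
  clique-within-edge K clique | yes (u , u∈K) | yes (w , w∈K , w≢u) =
    u , w , clique u w u∈K w∈K (≢-sym w≢u) , in-pair
    where
    in-pair : ∀ z → z ∈ K → z ≡ u ⊎ z ≡ w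
    in-pair z z∈K with z ≟ᶠ u | z ≟ᶠ w
    ... | yes z≡u | _ = inj₁ z≡u
    ... | no _ | yes z≡w = inj₂ z≡w
    ... | no z≢u | no z≢w = ⊥-elim (triangle-free u w z (clique u w u∈K w∈K (≢-sym w≢u))
                                      (clique w z w∈K z∈K (≢-sym z≢w)) (clique u z u∈K z∈K (≢-sym z≢u)))

  -- G minus an edge uw is connected, and each of u, w has a neighbour off the edge
  no-clique-separator : ¬ HasCliqueSeparator G
  no-clique-separator (K , clique , X , Y , CX , CY , X≢Y) with clique-within-edge K clique
  ... | u , w , uw , K⊆uw with edge-removal-connected uw
  ...   | r , _ , to-r = two-components-not-connected CX CY X≢Y r to-r′
    where
    widen : ∀ v → Outside (⁅ u ⁆ ∪ ⁅ w ⁆) v → Outside K v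
    widen v v∉ v∈K = v∉ (Equivalence.from ∈-pair (K⊆uw v v∈K))
    to-r′ : ∀ v → v ∉ K → Walk (Outside K) v r
    to-r′ v v∉K with v ∈? (⁅ u ⁆ ∪ ⁅ w ⁆)
    ... | no v∉ = mapʷ widen (to-r v v∉)
    ... | yes v∈ with two-neighbours v
    ...   | x , y , vx , vy , x≢y with x ∈? (⁅ u ⁆ ∪ ⁅ w ⁆) | y ∈? (⁅ u ⁆ ∪ ⁅ w ⁆)
    ...     | no x∉ | _ = wcons v∉K vx (mapʷ widen (to-r x x∉))
    ...     | yes _ | no y∉ = wcons v∉K vy (mapʷ widen (to-r y y∉))
    ...     | yes x∈ | yes y∈ = ⊥-elim (no-three-distinct-in-pair (Equivalence.to ∈-pair v∈)
              (Equivalence.to ∈-pair x∈) (Equivalence.to ∈-pair y∈) (E⇒≢ vx) (E⇒≢ vy) x≢y)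

module P3Separators {n : ℕ} (G : Graph n) (D : IsDaisy G) where
  open Walks G
  open Arcs G D

  IsPath-three : ∀ {a c b} → IsPath G (a ∷ c ∷ b ∷ []) → E G a c × E G c b × a ≢ b
  IsPath-three ((_ ∷ a≢b ∷ []) ∷ _ , adjacency) =
    Equivalence.from (adjacency Fin.zero (Fin.suc Fin.zero)) (inj₁ refl) ,
    Equivalence.from (adjacency (Fin.suc Fin.zero) (Fin.suc (Fin.suc Fin.zero))) (inj₁ refl) ,
    a≢b

  no-proper-P3-separator : ¬ HasProperP3Separator G
  no-proper-P3-separator (a , c , b , path , S , X , Y , S≡ , two , _ , _ , _ , _ , _ , _ , ¬X , ¬Y)
    with IsPath-three path
  ... | ac , cb , a≢b = [ ¬X , ¬Y ]′ (arc-cut-ABPath-component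
          (HoleArc-transport S≡ (triple-arc ac cb a≢b))
          (three-vertex-StretchEnds S≡ ac cb) two)
    where open Separation G D S

module TwoSeparators {n : ℕ} (G : Graph n) (D : IsDaisy G) where
  open Walks G
  open IndexedPaths G
  open IsDaisy D
  open Petals G D
  open LocalStructure G D
  open Arcs G D

  HasPetal : ℕ → Set
  HasPetal t = ∃[ P ] (petals (t mod k) ≡ just P)

  HasPetal? : ∀ t → Dec (HasPetal t)
  HasPetal? t with petals (t mod k)
  ... | just P = yes (P , refl)
  ... | nothing = no (λ { (_ , ()) })

  HasPetal-cong : ∀ t t' → cyc t ≡ cyc t' → HasPetal t → HasPetal t'
  HasPetal-cong t t' eq (P , listed) = P , subst (λ i → petals i ≡ just P) (c-injective _ _ eq) listed

  petal-at : ∀ t → HasPetal t → Σ PetalAt λ p → cyc (suc (ℓ p)) ≡ cyc t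
  petal-at t (petal x I y , listed) = petalAt (t mod k) x I y listed , sym (centre≡cyc (petalAt (t mod k) x I y listed))

  has-petal : ∀ p t → cyc (suc (ℓ p)) ≡ cyc t → HasPetal t
  has-petal p t eq = _ , subst (λ i → petals i ≡ just _) (c-injective _ _ (trans (centre≡cyc p) eq)) (PetalAt.listed p)

  -- the centres form a cyclic interval: if it contains neither β nor β + q, it lies on one side of them
  centres-on-one-side : ∀ β q d1 d2 → 0 < d1 → d1 < q → q < d2 → d2 < k → HasPetal (β + d1) → HasPetal (β + d2) →
                        ¬ HasPetal (β + 0) → ¬ HasPetal (β + q) → ⊥
  centres-on-one-side β q d1 d2 0<d1 d1<q q<d2 d2<k at-d1 at-d2 ¬at-0 ¬at-q with centres
  ... | s , m , m≤k , centre⇔ =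
    cyclic-interval-convex u m d1 q d2 (m%n<n _ k) 0<d1 d1<q q<d2 d2<k (inside d1 at-d1) (inside d2 at-d2) (outside 0 ¬at-0) (outside q ¬at-q)
    where
    u : ℕ
    u = (β + (k ∸ toℕ s)) % k
    offset≡ : ∀ d → offset (toℕ s) (toℕ ((β + d) mod k)) ≡ (u + d) % k
    offset≡ d = trans (cong (λ z → (z + (k ∸ toℕ s)) % k) (toℕ-mod (β + d))) (offset-shift β d (toℕ s))
    inside : ∀ d → HasPetal (β + d) → (u + d) % k < m
    inside d at-d = subst (_< m) (offset≡ d)
      (in-interval⇒offset< (toℕ s) _ m (toℕ<n s) (toℕ<n _) m≤k (Equivalence.to (centre⇔ _) at-d))
    outside : ∀ d → ¬ HasPetal (β + d) → ¬ ((u + d) % k < m)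
    outside d ¬at-d in-m = ¬at-d (Equivalence.from (centre⇔ _)
      (offset<⇒in-interval (toℕ s) _ m (toℕ<n s) (toℕ<n _) (subst (_< m) (sym (offset≡ d)) in-m)))

  -- a = cyc β and b = cyc (β + q) split the rest of the hole into the arcs β + (0, q) and β + (q, k)
  module HolePair {a b : Fin n} {S : Subset n} (S≡ : ∀ v → v ∈ S ⇔ (v ≡ a ⊎ v ≡ b)) (a≁b : ¬ E G a b)
                  (β q : ℕ) (a≡ : a ≡ cyc β) (b≡ : b ≡ cyc (β + q)) (2≤q : 2 ≤ q) (q+2≤k : q + 2 ≤ k) where
    open Separation G D S using (arc-walk)

    q<k : q < k
    q<k = ≤-trans (n≤1+n (suc q)) (≤-trans (≤-reflexive (+-comm 2 q)) q+2≤k)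

    a∈S : a ∈ S
    a∈S = Equivalence.from (S≡ a) (inj₁ refl)

    b∈S : b ∈ S
    b∈S = Equivalence.from (S≡ b) (inj₂ refl)

    hole-outside-S : ∀ d → d < k → d ≢ 0 → d ≢ q → cyc (β + d) ∉ S
    hole-outside-S d d<k d≢0 d≢q inS with Equivalence.to (S≡ _) inS
    ... | inj₁ eq = d≢0 (cyc-offset-injective β d 0 d<k 0<k (trans eq (trans a≡ (sym (cyc-+0 β)))))
    ... | inj₂ eq = d≢q (cyc-offset-injective β d q d<k q<k (trans eq b≡))

    first-arc-outside : ∀ d → 0 < d → d < q → cyc (β + d) ∉ S
    first-arc-outside d 0<d d<q = hole-outside-S d (<-trans d<q q<k) (>⇒≢ 0<d) (<⇒≢ d<q)

    second-arc-outside : ∀ d → q < d → d < k → cyc (β + d) ∉ S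
    second-arc-outside d q<d d<k = hole-outside-S d d<k (>⇒≢ (≤-<-trans z≤n q<d)) (>⇒≢ q<d)

    inner∉S : ∀ p s → s < len p → ext p (suc s) ∉ S
    inner∉S p s s< inS with Equivalence.to (S≡ _) inS
    ... | inj₁ eq = inner-off-hole p s s< (β mod k) (sym (trans eq a≡))
    ... | inj₂ eq = inner-off-hole p s s< ((β + q) mod k) (sym (trans eq b≡))

    r : Fin n
    r = cyc (β + 1)

    r∉S : r ∉ S
    r∉S = first-arc-outside 1 (s≤s z≤n) 2≤q

    first-arc-reaches-r : ∀ d → 0 < d → d < q → Walk (Outside S) (cyc (β + d)) r
    first-arc-reaches-r d 0<d d<q = arc-walk β 1 d (<-trans d<q q<k)
      (λ x 1≤x x≤d → first-arc-outside x 1≤x (≤-<-trans x≤d d<q)) d 1 0<d ≤-refl ≤-refl 0<d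

    second-arc-walk : ∀ x y → q < x → x < k → q < y → y < k → Walk (Outside S) (cyc (β + x)) (cyc (β + y))
    second-arc-walk x y q<x x<k q<y y<k = arc-walk β (suc q) (k ∸ 1) k∸1<k
      (λ z q<z z≤ → second-arc-outside z q<z (≤-<-trans z≤ k∸1<k)) x y q<x (≤k∸1 x<k) q<y (≤k∸1 y<k)
      where
      ≤k∸1 : ∀ {x} → x < k → x ≤ k ∸ 1
      ≤k∸1 {x} x<k = subst (x ≤_) (pred[m∸n]≡m∸[1+n] k 0) (<⇒≤pred x<k)

    inner-reaches-centre : ∀ p s → s < len p → cyc (suc (ℓ p)) ∉ S → Walk (Outside S) (ext p (suc s)) (cyc (suc (ℓ p)))
    inner-reaches-centre p s s< centre∉S with spoke p
    ... | s₀ , s₀< , spoke-adj =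
      snocʷ (walk-along (ext p) 1 (len p) avoid (λ t _ t< → consecutive-adjacent (ext-indexedPath p) t (m<n⇒m<1+n t<))
                        (suc s) (suc (suc s₀)) (s≤s z≤n) s< (s≤s z≤n) (s≤s (s≤s (<⇒≤ s₀<))))
            spoke-adj centre∉S
      where
      avoid : ∀ t → 1 ≤ t → t ≤ len p → ext p t ∉ S
      avoid (suc t) _ t< = inner∉S p t t<

    inner-reaches-left : ∀ p s → s < len p → cyc (ℓ p) ∉ S → Walk (Outside S) (ext p (suc s)) (cyc (ℓ p))
    inner-reaches-left p s s< left∉S =
      walk-along (ext p) 0 (len p) avoid (λ t _ t< → consecutive-adjacent (ext-indexedPath p) t (m<n⇒m<1+n t<))
                 (suc s) 0 z≤n s< z≤n z≤n
      where
      avoid : ∀ t → 0 ≤ t → t ≤ len p → ext p t ∉ S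
      avoid zero _ _ = left∉S
      avoid (suc t) _ t< = inner∉S p t t<

    petal-bridge : ∀ p → cyc (ℓ p) ∉ S → cyc (suc (suc (ℓ p))) ∉ S → Walk (Outside S) (cyc (ℓ p)) (cyc (suc (suc (ℓ p))))
    petal-bridge p left∉S right∉S = subst (Walk (Outside S) (cyc (ℓ p))) (ext-N p)
      (walk-along (ext p) 0 (N p) avoid (λ t _ t< → consecutive-adjacent (ext-indexedPath p) t t<) 0 (N p) z≤n z≤n z≤n ≤-refl)
      where
      avoid : ∀ t → 0 ≤ t → t ≤ N p → ext p t ∉ S
      avoid zero _ _ = left∉S
      avoid (suc t) _ t≤ with m≤n⇒m<n∨m≡n t≤
      ... | inj₁ t< = inner∉S p t (≤-pred t<)
      ... | inj₂ refl = subst (_∉ S) (sym (ext-N p)) right∉S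

    ¬left-and-centre-in-S : ∀ p → cyc (ℓ p) ∈ S → cyc (suc (ℓ p)) ∈ S → ⊥
    ¬left-and-centre-in-S p left∈S centre∈S with Equivalence.to (S≡ _) left∈S | Equivalence.to (S≡ _) centre∈S
    ... | inj₁ x | inj₁ y = cyc-≢-suc (ℓ p) (trans x (sym y))
    ... | inj₂ x | inj₂ y = cyc-≢-suc (ℓ p) (trans x (sym y))
    ... | inj₁ x | inj₂ y = a≁b (subst₂ (E G) x y (cyc-adjacent (ℓ p)))
    ... | inj₂ x | inj₁ y = a≁b (E-sym (subst₂ (E G) x y (cyc-adjacent (ℓ p))))

    hole-reaches-r : (∀ d → q < d → d < k → Walk (Outside S) (cyc (β + d)) r) → ∀ t → cyc t ∉ S → Walk (Outside S) (cyc t) r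
    hole-reaches-r second-reaches t t∉S with cyc-offset β t
    ... | zero , _ , eq = ⊥-elim (t∉S (subst (_∈ S) (trans a≡ (trans (sym (cyc-+0 β)) (sym eq))) a∈S))
    ... | suc d , d<k , eq with <-cmp (suc d) q
    ...   | tri< d<q _ _ = subst (λ z → Walk (Outside S) z r) (sym eq) (first-arc-reaches-r (suc d) (s≤s z≤n) d<q)
    ...   | tri≈ _ refl _ = ⊥-elim (t∉S (subst (_∈ S) (trans b≡ (sym eq)) b∈S))
    ...   | tri> _ _ q<d = subst (λ z → Walk (Outside S) z r) (sym eq) (second-reaches (suc d) q<d d<k)

    -- a petal vertex reaches the centre or, if the centre is in S, the left end of its petal
    all-reach-r : (∀ d → q < d → d < k → Walk (Outside S) (cyc (β + d)) r) → ∀ v → v ∉ S → Walk (Outside S) v r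
    all-reach-r second-reaches v v∉S with classify v
    ... | inj₁ (j , refl) = subst (λ z → Walk (Outside S) z r) (sym (c≡cyc j))
                              (hole-reaches-r second-reaches (toℕ j) (subst (_∉ S) (c≡cyc j) v∉S))
    ... | inj₂ (p , s , s< , refl) with cyc (suc (ℓ p)) ∈? S | cyc (ℓ p) ∈? S
    ...   | no centre∉S | _ = inner-reaches-centre p s s< centre∉S ++ʷ hole-reaches-r second-reaches _ centre∉S
    ...   | yes centre∈S | yes left∈S = ⊥-elim (¬left-and-centre-in-S p left∈S centre∈S)
    ...   | yes _ | no left∉S = inner-reaches-left p s s< left∉S ++ʷ hole-reaches-r second-reaches _ left∉S

    -- a petal centred at a (or b) joins the two arcs, so G \ S is connected
    bridged-connected : HasPetal (β + 0) ⊎ HasPetal (β + q) → ∀ v → v ∉ S → Walk (Outside S) v r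
    bridged-connected (inj₁ at-a) with petal-at (β + 0) at-a
    ... | p , centre≡ = all-reach-r λ d q<d d<k →
            second-arc-walk d (k ∸ 1) q<d d<k q<k∸1 k∸1<k ++ʷ subst₂ (Walk (Outside S)) left≡ right≡ (petal-bridge p left∉S right∉S)
      where
      q<k∸1 : q < k ∸ 1
      q<k∸1 = subst (q <_) (pred[m∸n]≡m∸[1+n] k 0) (<⇒≤pred (≤-trans (≤-reflexive (+-comm 2 q)) q+2≤k))
      left≡ : cyc (ℓ p) ≡ cyc (β + (k ∸ 1))
      left≡ = cyc-pred _ _ (trans centre≡ (trans (cyc-+0 β) (sym (trans (cong cyc (+-comm 1 (β + (k ∸ 1)))) (cyc-back₁ β)))))
      right≡ : cyc (suc (suc (ℓ p))) ≡ r
      right≡ = trans (cyc-suc _ _ centre≡) (cong cyc (trans (cong suc (+-identityʳ β)) (+-comm 1 β)))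
      left∉S : cyc (ℓ p) ∉ S
      left∉S = subst (_∉ S) (sym left≡) (second-arc-outside (k ∸ 1) q<k∸1 k∸1<k)
      right∉S : cyc (suc (suc (ℓ p))) ∉ S
      right∉S = subst (_∉ S) (sym right≡) r∉S
    bridged-connected (inj₂ at-b) with petal-at (β + q) at-b
    ... | p , centre≡ = all-reach-r λ d q<d d<k →
            second-arc-walk d (suc q) q<d d<k ≤-refl 2+q≤k ++ʷ
            subst₂ (Walk (Outside S)) right≡ left≡ (reverseʷ (petal-bridge p left∉S right∉S)) ++ʷ
            first-arc-reaches-r (pred q) 1≤q-1 q-1<q
      where
      2+q≤k : suc (suc q) ≤ k
      2+q≤k = ≤-trans (≤-reflexive (+-comm 2 q)) q+2≤k
      q≡ : suc (pred q) ≡ q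
      q≡ = suc-pred q {{>-nonZero (≤-trans (s≤s z≤n) 2≤q)}}
      1≤q-1 : 1 ≤ pred q
      1≤q-1 = pred-mono-≤ 2≤q
      q-1<q : pred q < q
      q-1<q = subst (pred q <_) q≡ (n<1+n (pred q))
      left≡ : cyc (ℓ p) ≡ cyc (β + pred q)
      left≡ = cyc-pred _ _ (trans centre≡ (cong cyc (trans (cong (β +_) (sym q≡)) (+-suc β (pred q)))))
      right≡ : cyc (suc (suc (ℓ p))) ≡ cyc (β + suc q)
      right≡ = trans (cyc-suc _ _ centre≡) (cong cyc (sym (+-suc β q)))
      left∉S : cyc (ℓ p) ∉ S
      left∉S = subst (_∉ S) (sym left≡) (first-arc-outside (pred q) 1≤q-1 q-1<q)
      right∉S : cyc (suc (suc (ℓ p))) ∉ S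
      right∉S = subst (_∉ S) (sym right≡) (second-arc-outside (suc q) (n<1+n q) 2+q≤k)

    -- with every centre strictly between a and b, the second arc is cut off: with a and b it is an induced path
    module CentresOnFirstArc (¬at-a : ¬ HasPetal (β + 0)) (¬at-b : ¬ HasPetal (β + q))
                             (none-on-second : ∀ d → q < d → d < k → ¬ HasPetal (β + d)) where

      centre-on-first-arc : ∀ p → ∃[ d ] ((0 < d × d < q) × cyc (suc (ℓ p)) ≡ cyc (β + d))
      centre-on-first-arc p with cyc-offset β (suc (ℓ p))
      ... | zero , _ , eq = ⊥-elim (¬at-a (has-petal p (β + 0) eq))
      ... | suc d , d<k , eq with <-cmp (suc d) q
      ...   | tri< d<q _ _ = suc d , (s≤s z≤n , d<q) , eq
      ...   | tri≈ _ d≡q _ = ⊥-elim (¬at-b (subst (λ z → HasPetal (β + z)) d≡q (has-petal p _ eq)))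
      ...   | tri> _ _ q<d = ⊥-elim (none-on-second (suc d) q<d d<k (has-petal p _ eq))

      private
        beyond-first-arc : ∀ {e} → q < e → e < k → ∀ e' → e' ≤ q → cyc (β + e) ≢ cyc (β + e')
        beyond-first-arc {e} q<e e<k e' e'≤q eq =
          <-irrefl refl (<-≤-trans q<e (subst (_≤ q) (sym (cyc-offset-injective β e e' e<k (≤-<-trans e'≤q q<k) eq)) e'≤q))

      second-arc-no-petal-neighbour : ∀ e → q < e → e < k → ∀ p s → s < len p → ¬ E G (cyc (β + e)) (ext p (suc s))
      second-arc-no-petal-neighbour e q<e e<k p s s< adj with centre-on-first-arc p | hole-neighbours-of-inner p s s< (β + e) adj
      ... | suc d , (_ , 1+d<q) , centre≡ | inj₁ is-left =
        beyond-first-arc q<e e<k d (<⇒≤ (<-trans (n<1+n d) 1+d<q)) (trans is-left (cyc-pred _ _ (trans centre≡ (cong cyc (+-suc β d)))))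
      ... | suc d , (_ , 1+d<q) , centre≡ | inj₂ (inj₁ is-centre) =
        beyond-first-arc q<e e<k (suc d) (<⇒≤ 1+d<q) (trans is-centre centre≡)
      ... | suc d , (_ , 1+d<q) , centre≡ | inj₂ (inj₂ is-right) =
        beyond-first-arc q<e e<k (suc (suc d)) 1+d<q (trans is-right (trans (cyc-suc _ _ centre≡) (cong cyc (sym (+-suc β (suc d))))))

      private
        M : ℕ
        M = k ∸ q

        g : ℕ → Fin n
        g x = cyc (β + q + x)

        g≡ : ∀ x → g x ≡ cyc (β + (q + x))
        g≡ x = cong cyc (+-assoc β q x)

        M<k : M < k
        M<k = ∸-monoʳ-< {k} {q} {0} (≤-trans (s≤s z≤n) 2≤q) (<⇒≤ q<k)

        M+2≤k : M + 2 ≤ k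
        M+2≤k = ≤-trans (+-monoʳ-≤ M 2≤q) (≤-reflexive (m∸n+n≡m (<⇒≤ q<k)))

        g0≡b : g 0 ≡ b
        g0≡b = trans (cyc-+0 (β + q)) (sym b≡)

        gM≡a : g M ≡ a
        gM≡a = trans (cong cyc (trans (+-assoc β q M) (cong (β +_) (m+[n∸m]≡n (<⇒≤ q<k))))) (trans (cyc-periodic β) (sym a≡))

        q+x<k : ∀ {x} → x < M → q + x < k
        q+x<k {x} x<M = subst (q + x <_) (m+[n∸m]≡n (<⇒≤ q<k)) (+-monoʳ-< q x<M)

        q<q+x : ∀ {x} → 0 < x → q < q + x
        q<q+x {x} 0<x = subst (_< q + x) (+-identityʳ q) (+-monoʳ-< q 0<x)

        second-arc-closed : ∀ x w → 0 < x → x < M → E G (g x) w → w ∉ S → ∃[ x' ] (0 < x' × x' < M × w ≡ g x')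
        second-arc-closed x w 0<x x<M adj w∉S with classify w
        ... | inj₂ (p , s , s< , refl) =
          ⊥-elim (second-arc-no-petal-neighbour (q + x) (q<q+x 0<x) (q+x<k x<M) p s s< (subst (λ z → E G z (ext p (suc s))) (g≡ x) adj))
        ... | inj₁ (j , refl) with c-offset (β + q) j
        ...   | d , d<k , w≡ with cyc-offset-adjacent (β + q) x d (<-trans x<M M<k) d<k (subst (E G (g x)) w≡ adj)
        ...     | inj₁ (inj₁ 1+x≡d) with d <? M
        ...       | yes d<M = d , subst (0 <_) 1+x≡d (s≤s z≤n) , d<M , w≡
        ...       | no d≮M = ⊥-elim (w∉S (subst (_∈ S)
                       (sym (trans w≡ (trans (cong g (≤-antisym (subst (_≤ M) 1+x≡d x<M) (≮⇒≥ d≮M))) gM≡a))) a∈S))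
        second-arc-closed x w 0<x x<M adj w∉S | inj₁ _ | d , d<k , w≡ | inj₁ (inj₂ (1+x≡k , _)) =
          ⊥-elim (<-irrefl 1+x≡k (≤-<-trans x<M M<k))
        second-arc-closed x w 0<x x<M adj w∉S | inj₁ _ | zero , d<k , w≡ | inj₂ (inj₁ _) =
          ⊥-elim (w∉S (subst (_∈ S) (sym (trans w≡ g0≡b)) b∈S))
        second-arc-closed x w 0<x x<M adj w∉S | inj₁ _ | suc d , d<k , w≡ | inj₂ (inj₁ 2+d≡x) =
          suc d , s≤s z≤n , <-trans (subst (suc d <_) 2+d≡x ≤-refl) x<M , w≡
        second-arc-closed x w 0<x x<M adj w∉S | inj₁ _ | d , d<k , w≡ | inj₂ (inj₂ (_ , x≡0)) =
          ⊥-elim (<-irrefl (sym x≡0) 0<x)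

      second-arc-ABPiece : ∀ d → q < d → d < k → ABPiece S a b (cyc (β + d))
      second-arc-ABPiece d q<d d<k = subst (ABPiece S a b) (trans (g≡ (d ∸ q)) (cong (λ z → cyc (β + z)) (m+[n∸m]≡n (<⇒≤ q<d))))
        (ABPiece-swap (segment⇒ABPiece g M (arc-indexedPath (β + q) M M+2≤k) 0 (d ∸ q) M
          (m<n⇒0<n∸m q<d) (∸-monoˡ-< d<k (<⇒≤ q<d)) ≤-refl g0≡b gM≡a
          (λ x 0<x x<M → subst (_∉ S) (sym (g≡ x)) (second-arc-outside (q + x) (q<q+x 0<x) (q+x<k x<M)))
          second-arc-closed))

      reaches-r-or-second-arc : ∀ v → v ∉ S → Walk (Outside S) v r ⊎ ABPiece S a b v
      reaches-r-or-second-arc v v∉S with classify v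
      ... | inj₂ (p , s , s< , refl) with centre-on-first-arc p
      ...   | d , (0<d , d<q) , centre≡ = inj₁ (inner-reaches-centre p s s< (subst (_∉ S) (sym centre≡) (first-arc-outside d 0<d d<q))
                                                ++ʷ subst (λ z → Walk (Outside S) z r) (sym centre≡) (first-arc-reaches-r d 0<d d<q))
      reaches-r-or-second-arc v v∉S | inj₁ (j , refl) with c-offset β j
      ... | zero , _ , eq = ⊥-elim (v∉S (subst (_∈ S) (trans a≡ (trans (sym (cyc-+0 β)) (sym eq))) a∈S))
      ... | suc d , d<k , eq with <-cmp (suc d) q
      ...   | tri< d<q _ _ = inj₁ (subst (λ z → Walk (Outside S) z r) (sym eq) (first-arc-reaches-r (suc d) (s≤s z≤n) d<q))
      ...   | tri≈ _ refl _ = ⊥-elim (v∉S (subst (_∈ S) (trans b≡ (sym eq)) b∈S))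
      ...   | tri> _ _ q<d = inj₂ (subst (ABPiece S a b) (sym eq) (second-arc-ABPiece (suc d) q<d d<k))

  module OnHole {a b : Fin n} {S X Y : Subset n} (S≡ : ∀ v → v ∈ S ⇔ (v ≡ a ⊎ v ≡ b)) (a≢b : a ≢ b) (a≁b : ¬ E G a b)
                (two : ExactlyTwoComponents G S X Y) (β q : ℕ) (q<k : q < k) (a≡ : a ≡ cyc β) (b≡ : b ≡ cyc (β + q)) where

    q≢0 : q ≢ 0
    q≢0 refl = a≢b (trans a≡ (trans (sym (cyc-+0 β)) (sym b≡)))

    q≢1 : q ≢ 1
    q≢1 refl = a≁b (subst₂ (E G) (sym a≡) (sym b≡) (cyc-+1-adjacent β))

    q≢k∸1 : q ≢ k ∸ 1
    q≢k∸1 refl = a≁b (E-sym (subst₂ (E G) (sym b≡) (sym a≡) (cyc-−1-adjacent β)))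

    2≤q : 2 ≤ q
    2≤q = ≤∧≢⇒< (n≢0⇒n>0 q≢0) (≢-sym q≢1)

    q+2≤k : q + 2 ≤ k
    q+2≤k = ≤-trans (≤-reflexive (+-comm q 2)) (≤∧≢⇒< q<k (λ 1+q≡k → q≢k∸1 (cong (_∸ 1) 1+q≡k)))

    module Forward = HolePair S≡ a≁b β q a≡ b≡ 2≤q q+2≤k

    S≡′ : ∀ v → v ∈ S ⇔ (v ≡ b ⊎ v ≡ a)
    S≡′ v = mk⇔ (λ v∈S → Sum.swap (Equivalence.to (S≡ v) v∈S)) (λ eq → Equivalence.from (S≡ v) (Sum.swap eq))

    around : β + q + (k ∸ q) ≡ β + k
    around = trans (+-assoc β q _) (cong (β +_) (m+[n∸m]≡n (<⇒≤ q<k)))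

    module Backward = HolePair S≡′ (λ ba → a≁b (E-sym ba)) (β + q) (k ∸ q) b≡
      (trans a≡ (sym (trans (cong cyc around) (cyc-periodic β))))
      (subst (_≤ k ∸ q) (m+n∸m≡n q 2) (∸-monoˡ-≤ q q+2≤k))
      (≤-trans (+-monoʳ-≤ (k ∸ q) 2≤q) (≤-reflexive (m∸n+n≡m (<⇒≤ q<k))))

    wrap-around : ∀ d → k ∸ q < d → d < k → ∃[ e ] ((0 < e × e < q) × cyc (β + q + d) ≡ cyc (β + e))
    wrap-around d k∸q<d d<k = q + d ∸ k , (m<n⇒0<n∸m k<q+d , e<q) , trans (cong cyc shift) (cyc-periodic (β + (q + d ∸ k)))
      where
      k<q+d : k < q + d
      k<q+d = subst₂ _<_ (m∸n+n≡m (<⇒≤ q<k)) (+-comm d q) (+-monoˡ-< q k∸q<d)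
      e<q : q + d ∸ k < q
      e<q = subst (q + d ∸ k <_) (m+n∸n≡m q k) (∸-monoˡ-< (+-monoʳ-< q d<k) (<⇒≤ k<q+d))
      shift : β + q + d ≡ β + (q + d ∸ k) + k
      shift = trans (+-assoc β q d) (trans (cong (β +_) (sym (m∸n+n≡m (<⇒≤ k<q+d)))) (sym (+-assoc β _ k)))

    bridged : HasPetal (β + 0) ⊎ HasPetal (β + q) → ⊥
    bridged at-a-or-b = let (CX , CY , X≢Y , _) = two in
      two-components-not-connected CX CY X≢Y Forward.r (Forward.bridged-connected at-a-or-b)

    ABPath-component : InducesABPath G a b X ⊎ InducesABPath G a b Y
    ABPath-component with HasPetal? (β + 0) | HasPetal? (β + q)
    ... | yes at-a | _ = ⊥-elim (bridged (inj₁ at-a))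
    ... | no _ | yes at-b = ⊥-elim (bridged (inj₂ at-b))
    ... | no ¬at-a | no ¬at-b with Search.some-below (λ d → 0 < d × HasPetal (β + d)) (λ d → (0 <? d) ×-dec HasPetal? (β + d)) q
    ...   | inj₁ (d1 , d1<q , 0<d1 , at-d1) = one-component-induces-ABPath two Forward.r Forward.r∉S
            (Forward.CentresOnFirstArc.reaches-r-or-second-arc ¬at-a ¬at-b
              λ d2 q<d2 d2<k at-d2 → centres-on-one-side β q d1 d2 0<d1 d1<q q<d2 d2<k at-d1 at-d2 ¬at-a ¬at-b)
    ...   | inj₂ none-on-first = one-component-induces-ABPath two Backward.r Backward.r∉S
            λ v v∉S → Sum.map₂ ABPiece-swap (Backward.CentresOnFirstArc.reaches-r-or-second-arc
              (λ at-b → ¬at-b (HasPetal-cong _ _ (cyc-+0 (β + q)) at-b))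
              (λ at-a → ¬at-a (HasPetal-cong _ _ (trans (cong cyc around) (trans (cyc-periodic β) (sym (cyc-+0 β)))) at-a))
              none-beyond v v∉S)
      where
      none-beyond : ∀ d → k ∸ q < d → d < k → ¬ HasPetal (β + q + d)
      none-beyond d k∸q<d d<k at-d with wrap-around d k∸q<d d<k
      ... | e , (0<e , e<q) , eq = none-on-first e e<q (0<e , HasPetal-cong _ _ eq at-d)

  no-proper-2-separator : ¬ HasProper2Separator G
  no-proper-2-separator (a , b , a≢b , a≁b , S , X , Y , S≡ , two , _ , ¬X , _ , ¬Y) = [ ¬X , ¬Y ]′ ABPath-component
    where
    open Separation G D S
    ABPath-component : InducesABPath G a b X ⊎ InducesABPath G a b Y
    ABPath-component with on-hole-or-off a | on-hole-or-off b
    ... | inj₂ a-off | _ = arc-cut-ABPath-component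
            (HoleArc-transport S≡ (pair-arc (inj₂ (inj₁ a-off))))
            (two-vertex-StretchEnds S≡) two
    ... | inj₁ _ | inj₂ b-off = arc-cut-ABPath-component
            (HoleArc-transport S≡ (pair-arc (inj₂ (inj₂ b-off))))
            (two-vertex-StretchEnds S≡) two
    ... | inj₁ (ta , a≡) | inj₁ (tb , b≡) with cyc-offset ta tb
    ...   | q , q<k , b≡′ = OnHole.ABPath-component S≡ a≢b a≁b two ta q q<k a≡ (trans b≡ b≡′)

lemmal : ∀ {n : ℕ} (G : Graph n) → IsDaisy G →
    ¬ HasCliqueSeparator G × ¬ HasProper2Separator G × ¬ HasProperP3Separator G
lemmal G D = CliqueSeparators.no-clique-separator G D ,
             TwoSeparators.no-proper-2-separator G D ,
             P3Separators.no-proper-P3-separator G D
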